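{- Let $n\ge3$. The number of $n\times n$ Ferrers diagrams $\mathcal{F}$ for which the pair $(\mathcal{F},3)$ is MDS-constructible is $$\frac{1}{n}\binom{2n-2}{n-1}+\frac{2}{n-1}\binom{2n-4}{n-2}.$$
   Context: $[i]=\{1,\dots,i\}$. An $n\times m$ Ferrers diagram is a subset $\mathcal{F}\subseteq[n]\times[m]$ such that $(1,1),(n,m)\in\mathcal{F}$; if $(i,j)\in\mathcal{F}$ and $j<m$ then $(i,j+1)\in\mathcal{F}$; and if $(i,j)\in\mathcal{F}$ and $i>1$ then $(i-1,j)\in\mathcal{F}$. Let $c_j=|\{i:(i,j)\in\mathcal{F}\}|$. For $1\le d\le\min\{n,m\}$ and $0\le j\le d-1$ set $\kappa_j(\mathcal{F},d)=\sum_{t=1}^{m-d+1+j}\max\{c_t-j,0\}$ and $\kappa(\mathcal{F},d)=\min_j\kappa_j(\mathcal{F},d)$. For $1\le i\le m+n-1$, $D_i=\{(a,b)\in[n]\times[m]: b-a=m-i\}$. The pair $(\mathcal{F},d)$ is MDS-constructible if $\kappa(\mathcal{F},d)=\sum_{i=1}^{m+n-1}\max\{0,|D_i\cap\mathcal{F}|-d+1\}$. -}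

module Defs where

open import Data.Bool using (Bool; true; false; _∧_; _∨_; not; if_then_else_)
open import Data.Nat using (ℕ; zero; suc; _+_; _*_; _∸_; _⊓_; _≡ᵇ_; _<ᵇ_; _/_)
open import Data.Nat.Combinatorics using (_C_)
open import Data.List using (List; []; _∷_; map; length; filterᵇ; foldr; upTo; concatMap)
open import Data.Nat.ListAction using (sum)
open import Data.Bool.ListAction using (and)
open import Data.Vec using (Vec; []; _∷_)

range : ℕ → List ℕ
range k = map suc (upTo k)

-- 1-based entry of a Boolean vector; indices outside [k] give false
vget : {k : ℕ} → Vec Bool k → ℕ → Bool
vget []       _             = false
vget (x ∷ xs) zero          = false
vget (x ∷ xs) (suc zero)    = x
vget (x ∷ xs) (suc (suc i)) = vget xs (suc i)

-- A subset of [n] × [m] is represented by an n × m Boolean matrix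
-- (n rows, m columns); (a , b) ∈ F  iff  mem F a b ≡ true  (1-based).
Subset : ℕ → ℕ → Set
Subset n m = Vec (Vec Bool m) n

mem : {n m : ℕ} → Subset n m → ℕ → ℕ → Bool
mem []      _             _ = false
mem (r ∷ F) zero          _ = false
mem (r ∷ F) (suc zero)    b = vget r b
mem (r ∷ F) (suc (suc a)) b = mem F (suc a) b

_⇒ᵇ_ : Bool → Bool → Bool
x ⇒ᵇ y = not x ∨ y

allᵇ : List ℕ → (ℕ → Bool) → Bool
allᵇ xs p = and (map p xs)

isFerrers : {n m : ℕ} → Subset n m → Bool
isFerrers {n} {m} F =
  mem F 1 1 ∧ mem F n m ∧
  allᵇ (range n) (λ i → allᵇ (range m) (λ j →
    ((mem F i j ∧ (j <ᵇ m)) ⇒ᵇ mem F i (suc j)) ∧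
    ((mem F i j ∧ (1 <ᵇ i)) ⇒ᵇ mem F (i ∸ 1) j)))

countᵇ : List ℕ → (ℕ → Bool) → ℕ
countᵇ xs p = length (filterᵇ p xs)

colLen : {n m : ℕ} → Subset n m → ℕ → ℕ
colLen {n} F t = countᵇ (range n) (λ i → mem F i t)

-- κ_j(F,d) = Σ_{t=1}^{m-d+1+j} max{c_t - j, 0}
kappaj : {n m : ℕ} → Subset n m → ℕ → ℕ → ℕ
kappaj {n} {m} F d j = sum (map (λ t → colLen F t ∸ j) (range ((m + 1 + j) ∸ d)))

-- κ(F,d) = min_{0 ≤ j ≤ d-1} κ_j(F,d)   (for d ≥ 1; the j = 0 term seeds the fold)
kappa : {n m : ℕ} → Subset n m → ℕ → ℕ
kappa F d = foldr _⊓_ (kappaj F d 0) (map (kappaj F d) (upTo d))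

-- |D_i ∩ F| with D_i = {(a,b) ∈ [n]×[m] : b - a = m - i}, i.e. b + i = m + a
diagSize : {n m : ℕ} → Subset n m → ℕ → ℕ
diagSize {n} {m} F i =
  sum (map (λ a → countᵇ (range m) (λ b → mem F a b ∧ ((b + i) ≡ᵇ (m + a)))) (range n))

-- Σ_{i=1}^{m+n-1} max{0, |D_i ∩ F| - d + 1}   (for d ≥ 1, max{0,x-d+1} = x ∸ (d ∸ 1))
diagBound : {n m : ℕ} → Subset n m → ℕ → ℕ
diagBound {n} {m} F d = sum (map (λ i → diagSize F i ∸ (d ∸ 1)) (range ((m + n) ∸ 1)))

isMDSConstructible : {n m : ℕ} → Subset n m → ℕ → Bool
isMDSConstructible F d = kappa F d ≡ᵇ diagBound F d

allVecs : (k : ℕ) → List (Vec Bool k)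
allVecs zero    = [] ∷ []
allVecs (suc k) = concatMap (λ v → (true ∷ v) ∷ (false ∷ v) ∷ []) (allVecs k)

allSubsets : (n m : ℕ) → List (Subset n m)
allSubsets zero    m = [] ∷ []
allSubsets (suc n) m = concatMap (λ F → map (λ r → r ∷ F) (allVecs m)) (allSubsets n m)

countMDSFerrers : ℕ → ℕ → ℕ
countMDSFerrers n d =
  length (filterᵇ (λ F → isFerrers F ∧ isMDSConstructible F d) (allSubsets n n))

-- (1/n) binom(2n-2, n-1) + (2/(n-1)) binom(2n-4, n-2), for n ≥ 2 (both divisions exact)
formula : ℕ → ℕ
formula zero = 0
formula (suc zero) = 0
formula (suc (suc k)) =
  ((2 * (suc k)) C (suc k)) / (suc (suc k)) + (2 * ((2 * k) C k)) / (suc k)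

-- An N × N Ferrers diagram F is determined by its row lengths N = k₁ ≥ k₂ ≥ ⋯ ≥ k_N ≥ 1. Then κ₀ = Σ (kₐ ∸ 2), κ₁ = Σ_{a≥2} (kₐ ∸ 1) and κ₂ = Σ_{a≥3} kₐ, while
-- the diagonals satisfy |D₁ ∩ F| = 1, |Dᵢ ∩ F| ≥ 2 for 2 ≤ i ≤ N and Σᵢ |Dᵢ ∩ F| = Σₐ kₐ.
-- Comparing κ with the diagonal bound through Σₐ kₐ shows that (F,3) is MDS-constructible iff the
-- number B of cells (a , b) of F with b < a is 1 when k₂ = N or all kₐ ≥ 2, and 0 otherwise.
-- Row-length sequences fitting inside a staircase are counted by Catalan numbers: those with B = 0
-- give C_{N-1}, and each of the two cases with B = 1 reduces to the case B = 0 one size smaller,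
-- giving C_{N-2}.
module Submission where

open import Defs
open import Data.Bool using (Bool; true; false; _∧_; _∨_; if_then_else_; T)
open import Data.Bool.Properties using (∧-comm; ∧-assoc; ∧-zeroʳ; ∧-identityʳ; ∨-zeroʳ; ∨-identityʳ)
open import Data.Nat using (ℕ; zero; suc; _+_; _*_; _∸_; _⊓_; _⊔_; _≡ᵇ_; _<ᵇ_; _≤ᵇ_; _≤_; _<_; z≤n; s≤s; _≟_; _≤?_; _<?_; _/_; z<s)
open import Data.Nat.Properties
open import Data.Nat.Combinatorics using (_C_; nCk+nC[k+1]≡[n+1]C[k+1]; nCk≡nC[n∸k])
open import Data.Nat.DivMod using (m*n/n≡m)
open import Data.Nat.Tactic.RingSolver using (solve-∀)
open import Data.Nat.ListAction using (sum)
open import Data.List using (List; []; _∷_; map; length; filterᵇ; upTo; concatMap; _++_; [_])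
open import Data.List.Properties using (upTo-∷ʳ; map-upTo; map-++; ++-assoc; ++-identityʳ)
open import Data.List.Relation.Unary.All using (All; []; _∷_)
import Data.List.Relation.Unary.All as All
open import Data.List.Relation.Unary.All.Properties using (concat⁺; map⁺; applyUpTo⁺₁)
open import Data.Vec using (Vec; []; _∷_)
import Data.Vec as Vec
open import Data.Unit using (⊤; tt)
open import Data.Empty using (⊥-elim)
open import Data.Product using (_×_; _,_; proj₁; proj₂)
open import Data.Sum using (inj₁; inj₂)
open import Relation.Nullary using (yes; no; contradiction)
open import Relation.Binary using (tri<; tri≈; tri>)
open import Relation.Binary.PropositionalEquality hiding ([_])
open import Function using (_∘_)

-- Finite sums

∑ : {A : Set} → List A → (A → ℕ) → ℕ
∑ xs f = sum (map f xs)

∑-++ : {A : Set} (xs ys : List A) (f : A → ℕ) → ∑ (xs ++ ys) f ≡ ∑ xs f + ∑ ys f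
∑-++ []       ys f = refl
∑-++ (x ∷ xs) ys f = trans (cong (f x +_) (∑-++ xs ys f)) (sym (+-assoc (f x) (∑ xs f) (∑ ys f)))

∑-map : {A B : Set} (xs : List A) (g : A → B) (f : B → ℕ) → ∑ (map g xs) f ≡ ∑ xs (f ∘ g)
∑-map []       g f = refl
∑-map (x ∷ xs) g f = cong (f (g x) +_) (∑-map xs g f)

∑-cong : {A : Set} (xs : List A) {f g : A → ℕ} → (∀ x → f x ≡ g x) → ∑ xs f ≡ ∑ xs g
∑-cong []       e = refl
∑-cong (x ∷ xs) e = cong₂ _+_ (e x) (∑-cong xs e)

∑-cong-All : {A : Set} (xs : List A) {P : A → Set} {f g : A → ℕ} →
             All P xs → (∀ x → P x → f x ≡ g x) → ∑ xs f ≡ ∑ xs g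
∑-cong-All []       []         e = refl
∑-cong-All (x ∷ xs) (px ∷ pxs) e = cong₂ _+_ (e x px) (∑-cong-All xs pxs e)

+-interchange : ∀ a b c d → (a + b) + (c + d) ≡ (a + c) + (b + d)
+-interchange = solve-∀

∑-+ : {A : Set} (xs : List A) (f g : A → ℕ) → ∑ xs (λ x → f x + g x) ≡ ∑ xs f + ∑ xs g
∑-+ []       f g = refl
∑-+ (x ∷ xs) f g = trans (cong (f x + g x +_) (∑-+ xs f g)) (+-interchange (f x) (g x) (∑ xs f) (∑ xs g))

∑-zero : {A : Set} (xs : List A) → ∑ xs (λ _ → 0) ≡ 0
∑-zero []       = refl
∑-zero (x ∷ xs) = ∑-zero xs

∑-concatMap : {A B : Set} (xs : List A) (g : A → List B) (f : B → ℕ) →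
              ∑ (concatMap g xs) f ≡ ∑ xs (λ x → ∑ (g x) f)
∑-concatMap []       g f = refl
∑-concatMap (x ∷ xs) g f = trans (∑-++ (g x) (concatMap g xs) f) (cong (∑ (g x) f +_) (∑-concatMap xs g f))

∑-swap : {A B : Set} (xs : List A) (ys : List B) (f : A → B → ℕ) →
         ∑ xs (λ x → ∑ ys (f x)) ≡ ∑ ys (λ y → ∑ xs (λ x → f x y))
∑-swap []       ys f = sym (∑-zero ys)
∑-swap (x ∷ xs) ys f =
  trans (cong (∑ ys (f x) +_) (∑-swap xs ys f)) (sym (∑-+ ys (f x) (λ y → ∑ xs (λ x′ → f x′ y))))

when : Bool → ℕ → ℕ
when b x = if b then x else 0

𝟙 : Bool → ℕ
𝟙 b = when b 1

when-∧ : ∀ a b x → when (a ∧ b) x ≡ when a (when b x)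
when-∧ true  b x = refl
when-∧ false b x = refl

when-comm : ∀ a b x → when a (when b x) ≡ when b (when a x)
when-comm true  true  x = refl
when-comm true  false x = refl
when-comm false true  x = refl
when-comm false false x = refl

∑-when : {A : Set} (xs : List A) (b : Bool) (f : A → ℕ) → ∑ xs (λ x → when b (f x)) ≡ when b (∑ xs f)
∑-when xs true  f = refl
∑-when xs false f = ∑-zero xs

∑-filterᵇ : {A : Set} (p : A → Bool) (xs : List A) (f : A → ℕ) →
            ∑ (filterᵇ p xs) f ≡ ∑ xs (λ x → when (p x) (f x))
∑-filterᵇ p []       f = refl
∑-filterᵇ p (x ∷ xs) f with p x
... | true  = cong (f x +_) (∑-filterᵇ p xs f)
... | false = ∑-filterᵇ p xs f

length-filterᵇ≡∑ : {A : Set} (p : A → Bool) (xs : List A) → length (filterᵇ p xs) ≡ ∑ xs (𝟙 ∘ p)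
length-filterᵇ≡∑ p []       = refl
length-filterᵇ≡∑ p (x ∷ xs) with p x
... | true  = cong suc (length-filterᵇ≡∑ p xs)
... | false = length-filterᵇ≡∑ p xs

<ᵇ-true : ∀ {m n} → m < n → (m <ᵇ n) ≡ true
<ᵇ-true {zero}  {suc n} _       = refl
<ᵇ-true {suc m} {suc n} (s≤s p) = <ᵇ-true p

<ᵇ-false : ∀ {m n} → n ≤ m → (m <ᵇ n) ≡ false
<ᵇ-false {m}     {zero}  _       = refl
<ᵇ-false {suc m} {suc n} (s≤s p) = <ᵇ-false p

≤ᵇ-true : ∀ {m n} → m ≤ n → (m ≤ᵇ n) ≡ true
≤ᵇ-true {zero}  _ = refl
≤ᵇ-true {suc m} p = <ᵇ-true p

≤ᵇ-false : ∀ {m n} → n < m → (m ≤ᵇ n) ≡ false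
≤ᵇ-false {suc m} (s≤s p) = <ᵇ-false p

≡ᵇ-true : ∀ {m n} → m ≡ n → (m ≡ᵇ n) ≡ true
≡ᵇ-true {zero}  refl = refl
≡ᵇ-true {suc m} refl = ≡ᵇ-true {m} refl

≡ᵇ-false : ∀ {m n} → m ≢ n → (m ≡ᵇ n) ≡ false
≡ᵇ-false {zero}  {zero}  ne = ⊥-elim (ne refl)
≡ᵇ-false {zero}  {suc n} ne = refl
≡ᵇ-false {suc m} {zero}  ne = refl
≡ᵇ-false {suc m} {suc n} ne = ≡ᵇ-false (ne ∘ cong suc)

<ᵇ-suc : ∀ m n → (m <ᵇ suc n) ≡ (m ≤ᵇ n)
<ᵇ-suc zero    n = refl
<ᵇ-suc (suc m) n = refl

+-≡ᵇ-cancelˡ : ∀ k m n → (k + m ≡ᵇ k + n) ≡ (m ≡ᵇ n)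
+-≡ᵇ-cancelˡ zero    m n = refl
+-≡ᵇ-cancelˡ (suc k) m n = +-≡ᵇ-cancelˡ k m n

≡ᵇ-cong : ∀ {m n u v} → (m ≡ n → u ≡ v) → (u ≡ v → m ≡ n) → (m ≡ᵇ n) ≡ (u ≡ᵇ v)
≡ᵇ-cong {m} {n} {u} {v} f g with m ≟ n | u ≟ v
... | yes p | yes q = trans (≡ᵇ-true p) (sym (≡ᵇ-true q))
... | yes p | no q  = ⊥-elim (q (f p))
... | no p  | yes q = ⊥-elim (p (g q))
... | no p  | no q  = trans (≡ᵇ-false p) (sym (≡ᵇ-false q))

range-sucˡ : ∀ n → range (suc n) ≡ 1 ∷ map suc (range n)
range-sucˡ n = cong (λ xs → 1 ∷ map suc xs) (sym (map-upTo suc n))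

upTo-sucʳ : ∀ n → upTo (suc n) ≡ upTo n ++ [ n ]
upTo-sucʳ n = sym (upTo-∷ʳ n)

range-sucʳ : ∀ n → range (suc n) ≡ range n ++ [ suc n ]
range-sucʳ n = trans (cong (map suc) (upTo-sucʳ n)) (map-++ suc (upTo n) [ n ])

range-+ : ∀ a b → range (a + b) ≡ range a ++ map (a +_) (range b)
range-+ a zero    = trans (cong range (+-identityʳ a)) (sym (++-identityʳ (range a)))
range-+ a (suc b) = begin
  range (a + suc b)                                      ≡⟨ cong range (+-suc a b) ⟩
  range (suc (a + b))                                    ≡⟨ range-sucʳ (a + b) ⟩
  range (a + b) ++ [ suc (a + b) ]                       ≡⟨ cong (_++ [ suc (a + b) ]) (range-+ a b) ⟩
  (range a ++ map (a +_) (range b)) ++ [ suc (a + b) ]   ≡⟨ ++-assoc (range a) _ _ ⟩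
  range a ++ (map (a +_) (range b) ++ [ suc (a + b) ])   ≡⟨ cong (λ z → range a ++ (map (a +_) (range b) ++ [ z ])) (sym (+-suc a b)) ⟩
  range a ++ (map (a +_) (range b) ++ map (a +_) [ suc b ]) ≡⟨ cong (range a ++_) (sym (map-++ (a +_) (range b) [ suc b ])) ⟩
  range a ++ map (a +_) (range b ++ [ suc b ])           ≡⟨ cong (λ z → range a ++ map (a +_) z) (sym (range-sucʳ b)) ⟩
  range a ++ map (a +_) (range (suc b))                  ∎
  where open ≡-Reasoning

∑-upTo-sucʳ : ∀ n (f : ℕ → ℕ) → ∑ (upTo (suc n)) f ≡ ∑ (upTo n) f + f n
∑-upTo-sucʳ n f = trans (cong (λ xs → ∑ xs f) (upTo-sucʳ n))
                        (trans (∑-++ (upTo n) [ n ] f) (cong (∑ (upTo n) f +_) (+-identityʳ (f n))))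

∑-upTo-cong : ∀ n {f g : ℕ → ℕ} → (∀ k → k < n → f k ≡ g k) → ∑ (upTo n) f ≡ ∑ (upTo n) g
∑-upTo-cong zero    e = refl
∑-upTo-cong (suc n) {f} {g} e =
  trans (∑-upTo-sucʳ n f)
    (trans (cong₂ _+_ (∑-upTo-cong n (λ k k<n → e k (m<n⇒m<1+n k<n))) (e n ≤-refl)) (sym (∑-upTo-sucʳ n g)))

∑-upTo-last : ∀ n (f : ℕ → ℕ) → ∑ (upTo (suc n)) (λ k → when (n ≤ᵇ k) (f k)) ≡ f n
∑-upTo-last n f = begin
  ∑ (upTo (suc n)) (λ k → when (n ≤ᵇ k) (f k))                     ≡⟨ ∑-upTo-sucʳ n _ ⟩
  ∑ (upTo n) (λ k → when (n ≤ᵇ k) (f k)) + when (n ≤ᵇ n) (f n)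
    ≡⟨ cong₂ _+_ (∑-upTo-cong n {g = λ _ → 0} (λ k k<n → cong (λ b → when b (f k)) (≤ᵇ-false k<n)))
                 (cong (λ b → when b (f n)) (≤ᵇ-true {n} ≤-refl)) ⟩
  ∑ (upTo n) (λ _ → 0) + f n                                        ≡⟨ cong (_+ f n) (∑-zero (upTo n)) ⟩
  f n                                                               ∎
  where open ≡-Reasoning

∑-upTo-single : ∀ n x (f : ℕ → ℕ) → ∑ (upTo n) (λ k → when (k ≡ᵇ x) (f k)) ≡ when (x <ᵇ n) (f x)
∑-upTo-single zero    x f = refl
∑-upTo-single (suc n) x f =
  trans (∑-upTo-sucʳ n _) (trans (cong (_+ when (n ≡ᵇ x) (f n)) (∑-upTo-single n x f)) last)
  where
  last : when (x <ᵇ n) (f x) + when (n ≡ᵇ x) (f n) ≡ when (x <ᵇ suc n) (f x)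
  last with <-cmp x n
  ... | tri< x<n _ _ rewrite <ᵇ-true x<n | ≡ᵇ-false (≢-sym (<⇒≢ x<n)) | <ᵇ-true (m<n⇒m<1+n x<n) = +-identityʳ _
  ... | tri≈ _ refl _ rewrite <ᵇ-false {x} {x} ≤-refl | ≡ᵇ-true {x} refl | <ᵇ-true (n<1+n x) = refl
  ... | tri> _ _ n<x rewrite <ᵇ-false (<⇒≤ n<x) | ≡ᵇ-false (<⇒≢ n<x) | <ᵇ-false {x} {suc n} n<x = refl

∑-range-sucˡ : ∀ n (f : ℕ → ℕ) → ∑ (range (suc n)) f ≡ f 1 + ∑ (range n) (f ∘ suc)
∑-range-sucˡ n f = trans (cong (λ xs → ∑ xs f) (range-sucˡ n)) (cong (f 1 +_) (∑-map (range n) suc f))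

∑-range-sucʳ : ∀ n (f : ℕ → ℕ) → ∑ (range (suc n)) f ≡ ∑ (range n) f + f (suc n)
∑-range-sucʳ n f = trans (cong (λ xs → ∑ xs f) (range-sucʳ n))
                         (trans (∑-++ (range n) [ suc n ] f) (cong (∑ (range n) f +_) (+-identityʳ _)))

∑-range-cong : ∀ n {f g : ℕ → ℕ} → (∀ x → x < n → f (suc x) ≡ g (suc x)) → ∑ (range n) f ≡ ∑ (range n) g
∑-range-cong zero    e = refl
∑-range-cong (suc n) {f} {g} e =
  trans (∑-range-sucˡ n f)
    (trans (cong₂ _+_ (e 0 z<s) (∑-range-cong n (λ x x<n → e (suc x) (s≤s x<n)))) (sym (∑-range-sucˡ n g)))

∑-range-+ : ∀ a b (f : ℕ → ℕ) → ∑ (range (a + b)) f ≡ ∑ (range a) f + ∑ (range b) (λ x → f (a + x))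
∑-range-+ a b f = trans (cong (λ xs → ∑ xs f) (range-+ a b))
                        (trans (∑-++ (range a) _ f) (cong (∑ (range a) f +_) (∑-map (range b) (a +_) f)))

∑-range-const : ∀ n c → ∑ (range n) (λ _ → c) ≡ n * c
∑-range-const zero    c = refl
∑-range-const (suc n) c = trans (∑-range-sucˡ n (λ _ → c)) (cong (c +_) (∑-range-const n c))

∑-range-≥-term : ∀ n x (f : ℕ → ℕ) → x < n → f (suc x) ≤ ∑ (range n) f
∑-range-≥-term (suc n) x f x<1+n with x ≟ n
... | yes refl = subst (f (suc x) ≤_) (sym (∑-range-sucʳ x f)) (m≤n+m (f (suc x)) _)
... | no x≢n   = subst (f (suc x) ≤_) (sym (∑-range-sucʳ n f))
                   (≤-trans (∑-range-≥-term n x f (≤∧≢⇒< (≤-pred x<1+n) x≢n)) (m≤m+n _ _))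

∑-range-when-< : ∀ n a (f : ℕ → ℕ) → a ≤ n → ∑ (range n) (λ b → when (b <ᵇ suc a) (f b)) ≡ ∑ (range a) f
∑-range-when-< n a f a≤n = begin
  ∑ (range n) g                                       ≡⟨ cong (λ z → ∑ (range z) g) (sym (m+[n∸m]≡n a≤n)) ⟩
  ∑ (range (a + (n ∸ a))) g                           ≡⟨ ∑-range-+ a (n ∸ a) g ⟩
  ∑ (range a) g + ∑ (range (n ∸ a)) (λ x → g (a + x))
    ≡⟨ cong₂ _+_ (∑-range-cong a (λ x x<a → cong (λ b → when b (f (suc x))) (<ᵇ-true (s≤s x<a))))
                 (trans (∑-range-cong (n ∸ a) {g = λ _ → 0} (λ x _ → cong (λ b → when b (f (a + suc x))) (<ᵇ-false (a<a+1+x x))))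
                        (∑-zero (range (n ∸ a)))) ⟩
  ∑ (range a) f + 0                                   ≡⟨ +-identityʳ _ ⟩
  ∑ (range a) f                                       ∎
  where
  open ≡-Reasoning
  g = λ b → when (b <ᵇ suc a) (f b)
  a<a+1+x : ∀ x → suc a ≤ a + suc x
  a<a+1+x x = subst (suc a ≤_) (sym (+-suc a x)) (s≤s (m≤m+n a x))

∑-range-single : ∀ n i c (f : ℕ → ℕ) →
                 ∑ (range n) (λ b → when (b + i ≡ᵇ c) (f b)) ≡ when ((i <ᵇ c) ∧ (c ≤ᵇ i + n)) (f (c ∸ i))
∑-range-single zero i c f with i <ᵇ c in i<ᵇc
... | false = refl
... | true  rewrite ≤ᵇ-false {c} {i + 0} (subst (_< c) (sym (+-identityʳ i)) (<ᵇ⇒< i c (subst T (sym i<ᵇc) tt))) = refl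
∑-range-single (suc n) i c f =
  trans (∑-range-sucʳ n g) (trans (cong (_+ g (suc n)) (∑-range-single n i c f)) last)
  where
  g = λ b → when (b + i ≡ᵇ c) (f b)
  widen : c ≢ suc n + i → (c ≤ᵇ i + n) ≡ (c ≤ᵇ i + suc n)
  widen c≢ with c ≤? i + n
  ... | yes c≤ = trans (≤ᵇ-true c≤) (sym (≤ᵇ-true (≤-trans c≤ (+-monoʳ-≤ i (n≤1+n n)))))
  ... | no c≰  = trans (≤ᵇ-false (≰⇒> c≰)) (sym (≤ᵇ-false (≤∧≢⇒< (subst (_≤ c) (sym (+-suc i n)) (≰⇒> c≰))
                                                              (λ e → c≢ (trans (sym e) (trans (+-suc i n) (cong suc (+-comm i n))))))))
  last : when ((i <ᵇ c) ∧ (c ≤ᵇ i + n)) (f (c ∸ i)) + g (suc n) ≡ when ((i <ᵇ c) ∧ (c ≤ᵇ i + suc n)) (f (c ∸ i))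
  last with c ≟ suc n + i
  ... | yes refl rewrite ≡ᵇ-true {suc n + i} refl | <ᵇ-true {i} {suc n + i} (s≤s (m≤n+m i n))
                       | ≤ᵇ-false {suc n + i} {i + n} (s≤s (≤-reflexive (+-comm i n)))
                       | ≤ᵇ-true {suc n + i} {i + suc n} (≤-reflexive (+-comm (suc n) i))
                       | m+n∸n≡m (suc n) i = refl
  ... | no c≢    rewrite ≡ᵇ-false (≢-sym c≢) | +-identityʳ (when ((i <ᵇ c) ∧ (c ≤ᵇ i + n)) (f (c ∸ i))) =
                   cong (λ b → when ((i <ᵇ c) ∧ b) (f (c ∸ i))) (widen c≢)

allᵇ-map : (xs : List ℕ) (g : ℕ → ℕ) (p : ℕ → Bool) → allᵇ (map g xs) p ≡ allᵇ xs (p ∘ g)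
allᵇ-map []       g p = refl
allᵇ-map (x ∷ xs) g p = cong (p (g x) ∧_) (allᵇ-map xs g p)

allᵇ-cong : (xs : List ℕ) {p q : ℕ → Bool} → (∀ x → p x ≡ q x) → allᵇ xs p ≡ allᵇ xs q
allᵇ-cong []       e = refl
allᵇ-cong (x ∷ xs) e = cong₂ _∧_ (e x) (allᵇ-cong xs e)

∧-interchange : ∀ a b c d → (a ∧ b) ∧ (c ∧ d) ≡ (a ∧ c) ∧ (b ∧ d)
∧-interchange true  b true  d = refl
∧-interchange true  b false d = ∧-zeroʳ b
∧-interchange false b c     d = refl

allᵇ-∧ : (xs : List ℕ) (p q : ℕ → Bool) → allᵇ xs (λ x → p x ∧ q x) ≡ allᵇ xs p ∧ allᵇ xs q
allᵇ-∧ []       p q = refl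
allᵇ-∧ (x ∷ xs) p q =
  trans (cong ((p x ∧ q x) ∧_) (allᵇ-∧ xs p q)) (∧-interchange (p x) (q x) (allᵇ xs p) (allᵇ xs q))

allᵇ-true : (xs : List ℕ) (p : ℕ → Bool) → (∀ x → p x ≡ true) → allᵇ xs p ≡ true
allᵇ-true []       p e = refl
allᵇ-true (x ∷ xs) p e rewrite e x = allᵇ-true xs p e

allᵇ-range-sucˡ : ∀ n (p : ℕ → Bool) → allᵇ (range (suc n)) p ≡ p 1 ∧ allᵇ (range n) (p ∘ suc)
allᵇ-range-sucˡ n p = trans (cong (λ xs → allᵇ xs p) (range-sucˡ n)) (cong (p 1 ∧_) (allᵇ-map (range n) suc p))

allᵇ-range-cong : ∀ n {p q : ℕ → Bool} → (∀ x → p (suc x) ≡ q (suc x)) → allᵇ (range n) p ≡ allᵇ (range n) q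
allᵇ-range-cong n {p} {q} e =
  trans (allᵇ-map (upTo n) suc p) (trans (allᵇ-cong (upTo n) e) (sym (allᵇ-map (upTo n) suc q)))

-- Ferrers diagrams as row-length sequences

-- The row of width m whose last k cells are filled.
suffix : (m : ℕ) → ℕ → Vec Bool m
suffix zero    k = []
suffix (suc m) k = (m <ᵇ k) ∷ suffix m k

ferrers : {n m : ℕ} → Vec ℕ n → Subset n m
ferrers {m = m} ks = Vec.map (suffix m) ks

head₀ : {n : ℕ} → Vec ℕ n → ℕ
head₀ []      = 0
head₀ (k ∷ _) = k

fromTo : ℕ → ℕ → List ℕ
fromTo h m = filterᵇ (h ≤ᵇ_) (upTo (suc m))

-- Nonincreasing sequences k₁ ≥ ⋯ ≥ kₙ of numbers ≤ m, built by prepending the largest entry.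
partitions : (n m : ℕ) → List (Vec ℕ n)
partitions zero    m = [] ∷ []
partitions (suc n) m = concatMap (λ ks → map (_∷ ks) (fromTo (head₀ ks) m)) (partitions n m)

IsPartition : ℕ → {n : ℕ} → Vec ℕ n → Set
IsPartition m []       = ⊤
IsPartition m (k ∷ ks) = (k ≤ m) × (head₀ ks ≤ k) × IsPartition m ks

head₀≤bound : ∀ {m n} (ks : Vec ℕ n) → IsPartition m ks → head₀ ks ≤ m
head₀≤bound []       _       = z≤n
head₀≤bound (k ∷ ks) (k≤m , _) = k≤m

All-filterᵇ : {P : ℕ → Set} (p : ℕ → Bool) (xs : List ℕ) → All P xs → All (λ x → P x × T (p x)) (filterᵇ p xs)
All-filterᵇ p []       []         = []
All-filterᵇ p (x ∷ xs) (px ∷ pxs) with p x in px≡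
... | true  = (px , subst T (sym px≡) tt) ∷ All-filterᵇ p xs pxs
... | false = All-filterᵇ p xs pxs

partitions-valid : ∀ n m → All (IsPartition m) (partitions n m)
partitions-valid zero    m = tt ∷ []
partitions-valid (suc n) m = concat⁺ (map⁺ (All.map {P = IsPartition m} extend (partitions-valid n m)))
  where
  extend : ∀ {ks : Vec ℕ n} → IsPartition m ks → All (IsPartition m) (map (_∷ ks) (fromTo (head₀ ks) m))
  extend {ks} valid = map⁺ (All.map (λ { {k} (k<1+m , h≤k) → ≤-pred k<1+m , ≤ᵇ⇒≤ (head₀ ks) k h≤k , valid })
                        (All-filterᵇ (head₀ ks ≤ᵇ_) (upTo (suc m)) (applyUpTo⁺₁ (λ x → x) (suc m) (λ i<n → i<n))))

∑-partitions-∷ : ∀ n m (f : Vec ℕ (suc n) → ℕ) →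
                 ∑ (partitions (suc n) m) f ≡ ∑ (partitions n m) (λ ks → ∑ (fromTo (head₀ ks) m) (λ k → f (k ∷ ks)))
∑-partitions-∷ n m f =
  trans (∑-concatMap (partitions n m) _ f) (∑-cong (partitions n m) (λ ks → ∑-map (fromTo (head₀ ks) m) (_∷ ks) f))

∑-fromTo-single : ∀ h m x (f : ℕ → ℕ) → ∑ (fromTo h m) (λ k → when (k ≡ᵇ x) (f k)) ≡ when ((h ≤ᵇ x) ∧ (x ≤ᵇ m)) (f x)
∑-fromTo-single h m x f = begin
  ∑ (fromTo h m) (λ k → when (k ≡ᵇ x) (f k))                   ≡⟨ ∑-filterᵇ (h ≤ᵇ_) (upTo (suc m)) _ ⟩
  ∑ (upTo (suc m)) (λ k → when (h ≤ᵇ k) (when (k ≡ᵇ x) (f k)))  ≡⟨ ∑-cong (upTo (suc m)) (λ k → when-comm (h ≤ᵇ k) (k ≡ᵇ x) (f k)) ⟩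
  ∑ (upTo (suc m)) (λ k → when (k ≡ᵇ x) (when (h ≤ᵇ k) (f k)))  ≡⟨ ∑-upTo-single (suc m) x _ ⟩
  when (x <ᵇ suc m) (when (h ≤ᵇ x) (f x))                       ≡⟨ cong (λ b → when b (when (h ≤ᵇ x) (f x))) (<ᵇ-suc x m) ⟩
  when (x ≤ᵇ m) (when (h ≤ᵇ x) (f x))                           ≡⟨ when-comm (x ≤ᵇ m) (h ≤ᵇ x) (f x) ⟩
  when (h ≤ᵇ x) (when (x ≤ᵇ m) (f x))                           ≡⟨ sym (when-∧ (h ≤ᵇ x) (x ≤ᵇ m) (f x)) ⟩
  when ((h ≤ᵇ x) ∧ (x ≤ᵇ m)) (f x)                              ∎
  where open ≡-Reasoning

∑-fromTo-last : ∀ h m (f : ℕ → ℕ) → h ≤ m → ∑ (fromTo h m) (λ k → when (m ≤ᵇ k) (f k)) ≡ f m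
∑-fromTo-last h m f h≤m = begin
  ∑ (fromTo h m) (λ k → when (m ≤ᵇ k) (f k))                   ≡⟨ ∑-filterᵇ (h ≤ᵇ_) (upTo (suc m)) _ ⟩
  ∑ (upTo (suc m)) (λ k → when (h ≤ᵇ k) (when (m ≤ᵇ k) (f k)))  ≡⟨ ∑-cong (upTo (suc m)) (λ k → when-comm (h ≤ᵇ k) (m ≤ᵇ k) (f k)) ⟩
  ∑ (upTo (suc m)) (λ k → when (m ≤ᵇ k) (when (h ≤ᵇ k) (f k)))  ≡⟨ ∑-upTo-last m (λ k → when (h ≤ᵇ k) (f k)) ⟩
  when (h ≤ᵇ m) (f m)                                           ≡⟨ cong (λ b → when b (f m)) (≤ᵇ-true h≤m) ⟩
  f m                                                           ∎
  where open ≡-Reasoning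

-- A closed subset of [n] × [m] is one satisfying the two closure conditions of a Ferrers
-- diagram; it is a Ferrers diagram iff it also contains (1,1) and (n,m).

closedAt : {n m : ℕ} → Subset n m → ℕ → ℕ → Bool
closedAt {n} {m} F i j = ((mem F i j ∧ (j <ᵇ m)) ⇒ᵇ mem F i (suc j)) ∧ ((mem F i j ∧ (1 <ᵇ i)) ⇒ᵇ mem F (i ∸ 1) j)

isClosed : {n m : ℕ} → Subset n m → Bool
isClosed {n} {m} F = allᵇ (range n) (λ i → allᵇ (range m) (closedAt F i))

rightClosed : {m : ℕ} → Vec Bool m → Bool
rightClosed {m} r = allᵇ (range m) (λ j → (vget r j ∧ (j <ᵇ m)) ⇒ᵇ vget r (suc j))

firstRow⊆ : {n m : ℕ} → Subset n m → Vec Bool m → Bool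
firstRow⊆ {n} {m} F r = allᵇ (range m) (λ j → mem F 1 j ⇒ᵇ vget r j)

rightClosed-∷ : {m : ℕ} (x : Bool) (v : Vec Bool m) →
                rightClosed (x ∷ v) ≡ ((x ∧ (1 <ᵇ suc m)) ⇒ᵇ vget v 1) ∧ rightClosed v
rightClosed-∷ {m} x v = trans (allᵇ-range-sucˡ m _) (cong (((x ∧ (1 <ᵇ suc m)) ⇒ᵇ vget v 1) ∧_) (allᵇ-range-cong m (λ _ → refl)))

⇒ᵇ-∧-false : ∀ x y → ((x ∧ false) ⇒ᵇ y) ≡ true
⇒ᵇ-∧-false true  y = refl
⇒ᵇ-∧-false false y = refl

isClosed-∷ : {n m : ℕ} (r : Vec Bool m) (F : Subset n m) → isClosed (r ∷ F) ≡ rightClosed r ∧ (firstRow⊆ F r ∧ isClosed F)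
isClosed-∷ {n} {m} r F = trans (allᵇ-range-sucˡ n _) (cong₂ _∧_ firstRow (lowerRows n F))
  where
  rightClosedAt : {k : ℕ} → Subset k m → ℕ → Bool
  rightClosedAt G j = (mem G 1 j ∧ (j <ᵇ m)) ⇒ᵇ mem G 1 (suc j)
  topRow : {k : ℕ} (G : Subset k m) → allᵇ (range m) (closedAt G 1) ≡ allᵇ (range m) (rightClosedAt G)
  topRow G = allᵇ-cong (range m) (λ j → trans (cong (rightClosedAt G j ∧_) (⇒ᵇ-∧-false (mem G 1 j) _)) (∧-identityʳ _))
  firstRow : allᵇ (range m) (closedAt (r ∷ F) 1) ≡ rightClosed r
  firstRow = topRow (r ∷ F)
  lowerRows : (n : ℕ) (F : Subset n m) →
              allᵇ (range n) (λ i → allᵇ (range m) (closedAt (r ∷ F) (suc i))) ≡ firstRow⊆ F r ∧ isClosed F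
  lowerRows zero    [] = sym (cong (_∧ true) (allᵇ-true (range m) _ (λ _ → refl)))
  lowerRows (suc n) F = begin
    allᵇ (range (suc n)) (λ i → allᵇ (range m) (closedAt (r ∷ F) (suc i)))
      ≡⟨ allᵇ-range-sucˡ n _ ⟩
    allᵇ (range m) (closedAt (r ∷ F) 2) ∧ allᵇ (range n) (λ i → allᵇ (range m) (closedAt (r ∷ F) (suc (suc i))))
      ≡⟨ cong₂ _∧_ secondRow (allᵇ-range-cong n (λ _ → refl)) ⟩
    (A ∧ firstRow⊆ F r) ∧ rest F                              ≡⟨ cong (_∧ rest F) (∧-comm A (firstRow⊆ F r)) ⟩
    (firstRow⊆ F r ∧ A) ∧ rest F                              ≡⟨ ∧-assoc (firstRow⊆ F r) A (rest F) ⟩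
    firstRow⊆ F r ∧ (A ∧ rest F)                              ≡⟨ cong (λ b → firstRow⊆ F r ∧ (b ∧ rest F)) (sym (topRow F)) ⟩
    firstRow⊆ F r ∧ (allᵇ (range m) (closedAt F 1) ∧ rest F)  ≡⟨ cong (firstRow⊆ F r ∧_) (sym (allᵇ-range-sucˡ n _)) ⟩
    firstRow⊆ F r ∧ isClosed F                                ∎
    where
    open ≡-Reasoning
    rest : Subset (suc n) m → Bool
    rest G = allᵇ (range n) (λ i → allᵇ (range m) (closedAt G (suc i)))
    A = allᵇ (range m) (rightClosedAt F)
    secondRow : allᵇ (range m) (closedAt (r ∷ F) 2) ≡ A ∧ firstRow⊆ F r
    secondRow = trans (allᵇ-cong (range m) (λ j → cong (λ z → rightClosedAt F j ∧ (z ⇒ᵇ vget r j)) (∧-identityʳ (mem F 1 j))))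
                      (allᵇ-∧ (range m) (rightClosedAt F) _)

suffix-full : ∀ m {k k′} → m ≤ k → m ≤ k′ → suffix m k ≡ suffix m k′
suffix-full zero    _   _    = refl
suffix-full (suc m) m<k m<k′ =
  cong₂ _∷_ (trans (<ᵇ-true m<k) (sym (<ᵇ-true m<k′))) (suffix-full m (≤-trans (n≤1+n m) m<k) (≤-trans (n≤1+n m) m<k′))

∑-rightClosed≡∑-suffix : ∀ m (f : Vec Bool m → ℕ) →
                         ∑ (allVecs m) (λ r → when (rightClosed r) (f r)) ≡ ∑ (upTo (suc m)) (f ∘ suffix m)
∑-rightClosed-true∷ : ∀ m (f : Vec Bool (suc m) → ℕ) →
                      ∑ (allVecs m) (λ v → when (rightClosed (true ∷ v)) (f (true ∷ v))) ≡ f (true ∷ suffix m m)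

∑-rightClosed≡∑-suffix zero    f = refl
∑-rightClosed≡∑-suffix (suc m) f = begin
  ∑ (allVecs (suc m)) g
    ≡⟨ ∑-concatMap (allVecs m) (λ v → (true ∷ v) ∷ (false ∷ v) ∷ []) g ⟩
  ∑ (allVecs m) (λ v → g (true ∷ v) + (g (false ∷ v) + 0))
    ≡⟨ ∑-cong (allVecs m) (λ v → cong (g (true ∷ v) +_) (+-identityʳ _)) ⟩
  ∑ (allVecs m) (λ v → g (true ∷ v) + g (false ∷ v))
    ≡⟨ ∑-+ (allVecs m) _ _ ⟩
  ∑ (allVecs m) (λ v → g (true ∷ v)) + ∑ (allVecs m) (λ v → g (false ∷ v))
    ≡⟨ cong₂ _+_ (∑-rightClosed-true∷ m f) false∷ ⟩
  f (true ∷ suffix m m) + ∑ (upTo (suc m)) (λ k → f (false ∷ suffix m k))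
    ≡⟨ +-comm (f (true ∷ suffix m m)) _ ⟩
  ∑ (upTo (suc m)) (λ k → f (false ∷ suffix m k)) + f (true ∷ suffix m m)
    ≡⟨ cong₂ _+_ (∑-upTo-cong (suc m) (λ k k≤m → cong (λ b → f (b ∷ suffix m k)) (sym (<ᵇ-false (≤-pred k≤m)))))
                 (cong₂ (λ b r → f (b ∷ r)) (sym (<ᵇ-true (n<1+n m))) (suffix-full m ≤-refl (n≤1+n m))) ⟩
  ∑ (upTo (suc m)) (f ∘ suffix (suc m)) + f (suffix (suc m) (suc m))
    ≡⟨ sym (∑-upTo-sucʳ (suc m) (f ∘ suffix (suc m))) ⟩
  ∑ (upTo (suc (suc m))) (f ∘ suffix (suc m)) ∎
  where
  open ≡-Reasoning
  g = λ r → when (rightClosed r) (f r)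
  false∷ : ∑ (allVecs m) (λ v → g (false ∷ v)) ≡ ∑ (upTo (suc m)) (λ k → f (false ∷ suffix m k))
  false∷ = trans (∑-cong (allVecs m) (λ v → cong (λ b → when b (f (false ∷ v))) (rightClosed-∷ false v)))
                 (∑-rightClosed≡∑-suffix m (λ v → f (false ∷ v)))

∑-rightClosed-true∷ zero    f = +-identityʳ _
∑-rightClosed-true∷ (suc m) f = begin
  ∑ (allVecs (suc m)) (λ v → when (rightClosed (true ∷ v)) (f (true ∷ v)))
    ≡⟨ ∑-cong (allVecs (suc m)) (λ v → trans (cong (λ b → when b (f (true ∷ v))) (rightClosed-∷ true v))
                                              (trans (when-∧ (vget v 1) (rightClosed v) _) (when-comm (vget v 1) (rightClosed v) _))) ⟩
  ∑ (allVecs (suc m)) (λ v → when (rightClosed v) (when (vget v 1) (f (true ∷ v))))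
    ≡⟨ ∑-rightClosed≡∑-suffix (suc m) (λ v → when (vget v 1) (f (true ∷ v))) ⟩
  ∑ (upTo (suc (suc m))) (λ k → when (suc m ≤ᵇ k) (f (true ∷ suffix (suc m) k)))
    ≡⟨ ∑-upTo-last (suc m) (λ k → f (true ∷ suffix (suc m) k)) ⟩
  f (true ∷ suffix (suc m) (suc m)) ∎
  where open ≡-Reasoning

suffix⊆ : (m h k : ℕ) → Bool
suffix⊆ m h k = allᵇ (range m) (λ j → vget (suffix m h) j ⇒ᵇ vget (suffix m k) j)

suffix⊆-suc : ∀ m h k → suffix⊆ (suc m) h k ≡ ((m <ᵇ h) ⇒ᵇ (m <ᵇ k)) ∧ suffix⊆ m h k
suffix⊆-suc m h k = trans (allᵇ-range-sucˡ m _) (cong (((m <ᵇ h) ⇒ᵇ (m <ᵇ k)) ∧_) (allᵇ-range-cong m (λ _ → refl)))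

suffix⊆-true : ∀ m h k → h ≤ k → suffix⊆ m h k ≡ true
suffix⊆-true zero    h k h≤k = refl
suffix⊆-true (suc m) h k h≤k rewrite suffix⊆-suc m h k | suffix⊆-true m h k h≤k with m <ᵇ h in m<ᵇh
... | false = refl
... | true  rewrite <ᵇ-true {m} {k} (≤-trans (<ᵇ⇒< m h (subst T (sym m<ᵇh) tt)) h≤k) = refl

suffix⊆-false : ∀ m h k → k < h → h ≤ m → suffix⊆ m h k ≡ false
suffix⊆-false zero    (suc h) k k<h ()
suffix⊆-false (suc m) h k k<h h≤1+m rewrite suffix⊆-suc m h k with h ≤? m
... | yes h≤m rewrite suffix⊆-false m h k k<h h≤m = ∧-zeroʳ _
... | no h≰m  rewrite <ᵇ-true {m} {h} (≰⇒> h≰m) | <ᵇ-false {m} {k} (≤-pred (≤-trans k<h h≤1+m)) = refl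

firstRow⊆-ferrers : ∀ {n m} (ks : Vec ℕ n) k → head₀ ks ≤ m → k ≤ m → firstRow⊆ (ferrers {m = m} ks) (suffix m k) ≡ (head₀ ks ≤ᵇ k)
firstRow⊆-ferrers {m = m} []       k _   _ = allᵇ-true (range m) _ (λ _ → refl)
firstRow⊆-ferrers {m = m} (h ∷ ks) k h≤m _ with h ≤? k
... | yes h≤k = trans (suffix⊆-true m h k h≤k) (sym (≤ᵇ-true h≤k))
... | no h≰k  = trans (suffix⊆-false m h k (≰⇒> h≰k) h≤m) (sym (≤ᵇ-false (≰⇒> h≰k)))

when-∧∧ : ∀ a b c x → when (a ∧ (b ∧ c)) x ≡ when c (when a (when b x))
when-∧∧ true  true  c     x = refl
when-∧∧ true  false true  x = refl
when-∧∧ true  false false x = refl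
when-∧∧ false b     true  x = refl
when-∧∧ false b     false x = refl

-- A closed subset is determined by its row lengths, which form a partition.
∑-closed≡∑-partitions : ∀ n m (w : Subset n m → ℕ) →
                        ∑ (allSubsets n m) (λ F → when (isClosed F) (w F)) ≡ ∑ (partitions n m) (w ∘ ferrers)
∑-closed≡∑-partitions zero    m w = refl
∑-closed≡∑-partitions (suc n) m w = begin
  ∑ (allSubsets (suc n) m) (λ F → when (isClosed F) (w F))
    ≡⟨ ∑-concatMap (allSubsets n m) (λ F → map (_∷ F) (allVecs m)) _ ⟩
  ∑ (allSubsets n m) (λ F → ∑ (map (_∷ F) (allVecs m)) (λ F′ → when (isClosed F′) (w F′)))
    ≡⟨ ∑-cong (allSubsets n m) (λ F → trans (∑-map (allVecs m) (_∷ F) _) (∑-cong (allVecs m) (λ r →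
         trans (cong (λ b → when b (w (r ∷ F))) (isClosed-∷ r F)) (when-∧∧ (rightClosed r) (firstRow⊆ F r) (isClosed F) _)))) ⟩
  ∑ (allSubsets n m) (λ F → ∑ (allVecs m) (λ r → when (isClosed F) (W′ F r)))
    ≡⟨ ∑-cong (allSubsets n m) (λ F → ∑-when (allVecs m) (isClosed F) _) ⟩
  ∑ (allSubsets n m) (λ F → when (isClosed F) (W F))
    ≡⟨ ∑-closed≡∑-partitions n m W ⟩
  ∑ (partitions n m) (W ∘ ferrers)
    ≡⟨ ∑-cong-All (partitions n m) (partitions-valid n m) extend ⟩
  ∑ (partitions n m) (λ ks → ∑ (fromTo (head₀ ks) m) (λ k → w (ferrers (k ∷ ks))))
    ≡⟨ sym (∑-partitions-∷ n m (w ∘ ferrers)) ⟩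
  ∑ (partitions (suc n) m) (w ∘ ferrers) ∎
  where
  open ≡-Reasoning
  W′ : Subset n m → Vec Bool m → ℕ
  W′ F r = when (rightClosed r) (when (firstRow⊆ F r) (w (r ∷ F)))
  W : Subset n m → ℕ
  W F = ∑ (allVecs m) (W′ F)
  extend : (ks : Vec ℕ n) → IsPartition m ks → W (ferrers ks) ≡ ∑ (fromTo (head₀ ks) m) (λ k → w (ferrers (k ∷ ks)))
  extend ks valid = begin
    W (ferrers ks)
      ≡⟨ ∑-rightClosed≡∑-suffix m _ ⟩
    ∑ (upTo (suc m)) (λ k → when (firstRow⊆ (ferrers ks) (suffix m k)) (w (suffix m k ∷ ferrers ks)))
      ≡⟨ ∑-upTo-cong (suc m) (λ k k≤m → cong (λ b → when b (w (suffix m k ∷ ferrers ks)))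
                                            (firstRow⊆-ferrers ks k (head₀≤bound ks valid) (≤-pred k≤m))) ⟩
    ∑ (upTo (suc m)) (λ k → when (head₀ ks ≤ᵇ k) (w (ferrers (k ∷ ks))))
      ≡⟨ sym (∑-filterᵇ (head₀ ks ≤ᵇ_) (upTo (suc m)) _) ⟩
    ∑ (fromTo (head₀ ks) m) (λ k → w (ferrers (k ∷ ks))) ∎

-- Column lengths and κⱼ of a Ferrers diagram

∑ᵥ : {n : ℕ} → (ℕ → ℕ) → Vec ℕ n → ℕ
∑ᵥ f []       = 0
∑ᵥ f (k ∷ ks) = f k + ∑ᵥ f ks

∑ᵥ-cong : ∀ {n} (ks : Vec ℕ n) {f g : ℕ → ℕ} → (∀ k → f k ≡ g k) → ∑ᵥ f ks ≡ ∑ᵥ g ks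
∑ᵥ-cong []       e = refl
∑ᵥ-cong (k ∷ ks) e = cong₂ _+_ (e k) (∑ᵥ-cong ks e)

-- 1-based entry, 0 out of range
entry : {n : ℕ} → Vec ℕ n → ℕ → ℕ
entry []       _             = 0
entry (k ∷ ks) zero          = 0
entry (k ∷ ks) (suc zero)    = k
entry (k ∷ ks) (suc (suc i)) = entry ks (suc i)

∑-range-entry : ∀ {n} (ks : Vec ℕ n) (f : ℕ → ℕ) → ∑ (range n) (f ∘ entry ks) ≡ ∑ᵥ f ks
∑-range-entry []            f = refl
∑-range-entry {suc n} (k ∷ ks) f =
  trans (∑-range-sucˡ n _) (cong (f k +_) (trans (∑-range-cong n (λ _ _ → refl)) (∑-range-entry ks f)))

entry≤bound : ∀ {m n} (ks : Vec ℕ n) a → IsPartition m ks → a < n → entry ks (suc a) ≤ m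
entry≤bound (k ∷ ks) zero    (k≤m , _)     _       = k≤m
entry≤bound (k ∷ ks) (suc a) (_ , _ , valid) (s≤s a<n) = entry≤bound ks a valid a<n

vget-suffix : ∀ m k b → b < m → vget (suffix m k) (suc b) ≡ (m <ᵇ suc b + k)
vget-suffix (suc m) k zero    _         = refl
vget-suffix (suc m) k (suc b) (s≤s b<m) = vget-suffix m k b b<m

vget-beyond : ∀ {m} (v : Vec Bool m) b → m ≤ b → vget v (suc b) ≡ false
vget-beyond []      b       _       = refl
vget-beyond (x ∷ v) (suc b) (s≤s p) = vget-beyond v b p

vget-zero : ∀ {m} (v : Vec Bool m) → vget v 0 ≡ false
vget-zero []      = refl
vget-zero (x ∷ v) = refl

mem-ferrers : ∀ {n m} (ks : Vec ℕ n) a b → a < n → mem (ferrers {m = m} ks) (suc a) b ≡ vget (suffix m (entry ks (suc a))) b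
mem-ferrers (k ∷ ks) zero    b _         = refl
mem-ferrers (k ∷ ks) (suc a) b (s≤s a<n) = mem-ferrers ks a b a<n

suffix-antitone : ∀ m {h k} t → k ≤ h → vget (suffix m h) t ≡ false → vget (suffix m k) t ≡ false
suffix-antitone m zero    k≤h _ = vget-zero (suffix m _)
suffix-antitone m {h} {k} (suc t) k≤h t∉h with t <? m
... | no t≮m  = vget-beyond (suffix m k) t (≮⇒≥ t≮m)
... | yes t<m = trans (vget-suffix m k t t<m) (<ᵇ-false (≤-trans (+-monoʳ-≤ (suc t) k≤h) t+h≤m))
  where
  t+h≤m : suc t + h ≤ m
  t+h≤m with m <? suc t + h
  ... | yes m<t+h = contradiction (trans (sym (<ᵇ-true m<t+h)) (trans (sym (vget-suffix m h t t<m)) t∉h)) λ ()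
  ... | no m≮t+h  = ≮⇒≥ m≮t+h

∑-suffix : ∀ m h L → h ≤ m → L ≤ m → ∑ (range L) (𝟙 ∘ vget (suffix m h)) ≡ (L + h) ∸ m
∑-suffix m h zero    h≤m _   = sym (m≤n⇒m∸n≡0 h≤m)
∑-suffix m h (suc L) h≤m L<m = begin
  ∑ (range (suc L)) (𝟙 ∘ vget (suffix m h))                  ≡⟨ ∑-range-sucʳ L _ ⟩
  ∑ (range L) (𝟙 ∘ vget (suffix m h)) + 𝟙 (vget (suffix m h) (suc L))
    ≡⟨ cong₂ _+_ (∑-suffix m h L h≤m (≤-trans (n≤1+n L) L<m)) (cong 𝟙 (vget-suffix m h L L<m)) ⟩
  (L + h) ∸ m + 𝟙 (m <ᵇ suc L + h)                           ≡⟨ step ⟩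
  (suc L + h) ∸ m                                            ∎
  where
  open ≡-Reasoning
  step : (L + h) ∸ m + 𝟙 (m <ᵇ suc L + h) ≡ (suc L + h) ∸ m
  step with m ≤? L + h
  ... | yes m≤ rewrite <ᵇ-true {m} {suc L + h} (s≤s m≤) = trans (+-comm _ 1) (sym (+-∸-assoc 1 m≤))
  ... | no m≰  rewrite <ᵇ-false {m} {suc L + h} (≰⇒> m≰) | m≤n⇒m∸n≡0 (<⇒≤ (≰⇒> m≰)) = sym (m≤n⇒m∸n≡0 (≰⇒> m≰))

colLen-ferrers-∷ : ∀ {n m} h (ks : Vec ℕ n) t → colLen (ferrers {m = m} (h ∷ ks)) t ≡ 𝟙 (vget (suffix m h) t) + colLen (ferrers {m = m} ks) t
colLen-ferrers-∷ {n} {m} h ks t = begin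
  colLen (ferrers {m = m} (h ∷ ks)) t                                    ≡⟨ length-filterᵇ≡∑ _ (range (suc n)) ⟩
  ∑ (range (suc n)) (λ a → 𝟙 (mem (ferrers {m = m} (h ∷ ks)) a t))       ≡⟨ ∑-range-sucˡ n _ ⟩
  𝟙 (vget (suffix m h) t) + ∑ (range n) (λ a → 𝟙 (mem (ferrers {m = m} (h ∷ ks)) (suc a) t))
    ≡⟨ cong (𝟙 (vget (suffix m h) t) +_) (∑-range-cong n (λ _ _ → refl)) ⟩
  𝟙 (vget (suffix m h) t) + ∑ (range n) (λ a → 𝟙 (mem (ferrers {m = m} ks) a t))
    ≡⟨ cong (𝟙 (vget (suffix m h) t) +_) (sym (length-filterᵇ≡∑ _ (range n))) ⟩
  𝟙 (vget (suffix m h) t) + colLen (ferrers {m = m} ks) t                ∎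
  where open ≡-Reasoning

colLen-ferrers-zero : ∀ {n m} (ks : Vec ℕ n) h t → head₀ ks ≤ h → IsPartition m ks →
                      vget (suffix m h) t ≡ false → colLen (ferrers {m = m} ks) t ≡ 0
colLen-ferrers-zero []       h t _   _               _   = refl
colLen-ferrers-zero {m = m} (k ∷ ks) h t k≤h (_ , h′≤k , valid) t∉h =
  trans (colLen-ferrers-∷ k ks t)
        (cong₂ _+_ (cong 𝟙 (suffix-antitone m t k≤h t∉h)) (colLen-ferrers-zero ks h t (≤-trans h′≤k k≤h) valid t∉h))

∑-colLen-ferrers : ∀ {n m} L (ks : Vec ℕ n) → L ≤ m → IsPartition m ks →
                   ∑ (range L) (colLen (ferrers {m = m} ks)) ≡ ∑ᵥ (λ k → (L + k) ∸ m) ks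
∑-colLen-ferrers L []       L≤m _ = ∑-zero (range L)
∑-colLen-ferrers {m = m} L (h ∷ ks) L≤m (h≤m , _ , valid) = begin
  ∑ (range L) (colLen (ferrers {m = m} (h ∷ ks)))
    ≡⟨ ∑-cong (range L) (colLen-ferrers-∷ h ks) ⟩
  ∑ (range L) (λ t → 𝟙 (vget (suffix m h) t) + colLen (ferrers {m = m} ks) t)
    ≡⟨ ∑-+ (range L) _ _ ⟩
  ∑ (range L) (𝟙 ∘ vget (suffix m h)) + ∑ (range L) (colLen (ferrers {m = m} ks))
    ≡⟨ cong₂ _+_ (∑-suffix m h L h≤m L≤m) (∑-colLen-ferrers L ks L≤m valid) ⟩
  (L + h) ∸ m + ∑ᵥ (λ k → (L + k) ∸ m) ks ∎
  where open ≡-Reasoning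

colLen-ferrers-full∷ : ∀ {n m} (ks : Vec ℕ n) t → t < m → colLen (ferrers {m = m} (m ∷ ks)) (suc t) ≡ suc (colLen (ferrers {m = m} ks) (suc t))
colLen-ferrers-full∷ {m = m} ks t t<m =
  trans (colLen-ferrers-∷ m ks (suc t)) (cong (λ b → 𝟙 b + colLen (ferrers {m = m} ks) (suc t))
                                              (trans (vget-suffix m m t t<m) (<ᵇ-true (s≤s (m≤n+m m t)))))

module _ (N′ : ℕ) where
  private
    N = suc (suc N′)

  kappaj-length : ∀ j → (N + 1 + j) ∸ 3 ≡ N′ + j
  kappaj-length j = cong (_∸ 1) (trans (+-assoc N′ 1 j) (+-suc N′ j))

  kappa₀-ferrers : (ks : Vec ℕ N) → IsPartition N ks → kappaj (ferrers {m = N} ks) 3 0 ≡ ∑ᵥ (_∸ 2) ks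
  kappa₀-ferrers ks valid = begin
    ∑ (range ((N + 1 + 0) ∸ 3)) (colLen (ferrers {m = N} ks))  ≡⟨ cong (λ z → ∑ (range z) (colLen (ferrers {m = N} ks))) (trans (kappaj-length 0) (+-identityʳ N′)) ⟩
    ∑ (range N′) (colLen (ferrers {m = N} ks))                 ≡⟨ ∑-colLen-ferrers N′ ks (≤-trans (n≤1+n N′) (n≤1+n _)) valid ⟩
    ∑ᵥ (λ k → (N′ + k) ∸ N) ks                                 ≡⟨ ∑ᵥ-cong ks (λ k → trans (cong (N′ + k ∸_) (+-comm 2 N′)) ([m+n]∸[m+o]≡n∸o N′ k 2)) ⟩
    ∑ᵥ (_∸ 2) ks                                               ∎
    where open ≡-Reasoning

  kappa₁-ferrers : (ks : Vec ℕ (suc N′)) → IsPartition N ks → kappaj (ferrers {m = N} (N ∷ ks)) 3 1 ≡ ∑ᵥ (_∸ 1) ks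
  kappa₁-ferrers ks valid = begin
    ∑ (range ((N + 1 + 1) ∸ 3)) (λ t → colLen (ferrers {m = N} (N ∷ ks)) t ∸ 1)
      ≡⟨ cong (λ z → ∑ (range z) (λ t → colLen (ferrers {m = N} (N ∷ ks)) t ∸ 1)) (kappaj-length 1) ⟩
    ∑ (range (N′ + 1)) (λ t → colLen (ferrers {m = N} (N ∷ ks)) t ∸ 1)
      ≡⟨ ∑-range-cong (N′ + 1) (λ t t< → cong (_∸ 1) (colLen-ferrers-full∷ ks t (≤-trans t< N′+1≤N))) ⟩
    ∑ (range (N′ + 1)) (colLen (ferrers {m = N} ks))
      ≡⟨ ∑-colLen-ferrers (N′ + 1) ks N′+1≤N valid ⟩
    ∑ᵥ (λ k → (N′ + 1 + k) ∸ N) ks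
      ≡⟨ ∑ᵥ-cong ks (λ k → trans (cong₂ _∸_ (+-assoc N′ 1 k) (+-comm 2 N′)) ([m+n]∸[m+o]≡n∸o N′ (suc k) 2)) ⟩
    ∑ᵥ (_∸ 1) ks ∎
    where
    open ≡-Reasoning
    N′+1≤N : N′ + 1 ≤ N
    N′+1≤N = ≤-trans (≤-reflexive (+-comm N′ 1)) (n≤1+n _)

  kappa₂-ferrers : ∀ k₂ (ks : Vec ℕ N′) → IsPartition N (k₂ ∷ ks) → kappaj (ferrers {m = N} (N ∷ k₂ ∷ ks)) 3 2 ≡ ∑ᵥ (λ k → k) ks
  kappa₂-ferrers k₂ ks (_ , h≤k₂ , valid) = begin
    ∑ (range ((N + 1 + 2) ∸ 3)) (λ t → colLen (ferrers {m = N} (N ∷ k₂ ∷ ks)) t ∸ 2)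
      ≡⟨ cong (λ z → ∑ (range z) (λ t → colLen (ferrers {m = N} (N ∷ k₂ ∷ ks)) t ∸ 2)) (trans (kappaj-length 2) (+-comm N′ 2)) ⟩
    ∑ (range N) (λ t → colLen (ferrers {m = N} (N ∷ k₂ ∷ ks)) t ∸ 2)
      ≡⟨ ∑-range-cong N {λ t → colLen (ferrers {m = N} (N ∷ k₂ ∷ ks)) t ∸ 2} {colLen (ferrers {m = N} ks)} (λ t t<N → trans (cong (_∸ 2) (trans (colLen-ferrers-full∷ (k₂ ∷ ks) t t<N) (cong suc (colLen-ferrers-∷ {m = N} k₂ ks (suc t)))))
                                         (secondRow {suc t} (vget (suffix N k₂) (suc t)) refl)) ⟩
    ∑ (range N) (colLen (ferrers {m = N} ks))
      ≡⟨ ∑-colLen-ferrers N ks ≤-refl valid ⟩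
    ∑ᵥ (λ k → (N + k) ∸ N) ks
      ≡⟨ ∑ᵥ-cong ks (m+n∸m≡n N) ⟩
    ∑ᵥ (λ k → k) ks ∎
    where
    open ≡-Reasoning
    -- below row 2 a column is empty unless it meets row 2
    secondRow : ∀ {t} b → vget (suffix N k₂) t ≡ b → (𝟙 b + colLen (ferrers {m = N} ks) t) ∸ 1 ≡ colLen (ferrers {m = N} ks) t
    secondRow true  _   = refl
    secondRow {t} false t∉k₂ rewrite colLen-ferrers-zero ks k₂ t h≤k₂ valid t∉k₂ = refl

-- Diagonals of a Ferrers diagram

-- ∑ᵢ g ks = Σₐ g a kₐ, positions a counted from 1
∑ᵢ : {n : ℕ} → (ℕ → ℕ → ℕ) → Vec ℕ n → ℕ
∑ᵢ g []       = 0
∑ᵢ g (k ∷ ks) = g 1 k + ∑ᵢ (g ∘ suc) ks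

∑-range-entryᵢ : ∀ {n} (ks : Vec ℕ n) (g : ℕ → ℕ → ℕ) → ∑ (range n) (λ a → g a (entry ks a)) ≡ ∑ᵢ g ks
∑-range-entryᵢ []               g = refl
∑-range-entryᵢ {suc n} (k ∷ ks) g =
  trans (∑-range-sucˡ n _) (cong (g 1 k +_) (trans (∑-range-cong n (λ _ _ → refl)) (∑-range-entryᵢ ks (g ∘ suc))))

∑ᵢ-cong : ∀ {n} (ks : Vec ℕ n) {g h : ℕ → ℕ → ℕ} → (∀ a k → g (suc a) k ≡ h (suc a) k) → ∑ᵢ g ks ≡ ∑ᵢ h ks
∑ᵢ-cong []       e = refl
∑ᵢ-cong (k ∷ ks) e = cong₂ _+_ (e 0 k) (∑ᵢ-cong ks (e ∘ suc))

-- The number of cells (a , b) with b < a in the diagram with row lengths ks.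
belowDiagonal : {n : ℕ} → Vec ℕ n → ℕ
belowDiagonal []               = 0
belowDiagonal {suc n} (k ∷ ks) = (k ∸ suc n) + belowDiagonal ks

belowDiagonal-∑ᵢ : ∀ {n} (ks : Vec ℕ n) → ∑ᵢ (λ a k → ((a ∸ 1) + k) ∸ n) ks ≡ belowDiagonal ks
belowDiagonal-∑ᵢ []               = refl
belowDiagonal-∑ᵢ {suc n} (k ∷ ks) =
  cong (k ∸ suc n +_) (trans (∑ᵢ-cong ks (λ _ _ → refl)) (belowDiagonal-∑ᵢ ks))

allPositive : {n : ℕ} → Vec ℕ n → Bool
allPositive []       = true
allPositive (k ∷ ks) = (1 ≤ᵇ k) ∧ allPositive ks

AllPositive : {n : ℕ} → Vec ℕ n → Set
AllPositive ks = T (allPositive ks)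

entry-positive : ∀ {n} (ks : Vec ℕ n) a → AllPositive ks → a < n → 1 ≤ entry ks (suc a)
entry-positive (suc k ∷ ks) zero    _   _         = s≤s z≤n
entry-positive (suc k ∷ ks) (suc a) pos (s≤s a<n) = entry-positive ks a pos a<n

mem-ferrers-last : ∀ N (ks : Vec ℕ N) a → a < N → AllPositive ks → mem (ferrers {m = N} ks) (suc a) N ≡ true
mem-ferrers-last (suc N) ks a a<N pos =
  trans (mem-ferrers ks a (suc N) a<N)
        (trans (vget-suffix (suc N) _ N ≤-refl) (<ᵇ-true (m<m+n (suc N) (entry-positive ks a pos a<N))))

mem-ferrers-first : ∀ N (ks : Vec ℕ N) b → 0 < b → b ≤ N → entry ks 1 ≡ N → mem (ferrers {m = N} ks) 1 b ≡ true
mem-ferrers-first (suc N) (k ∷ ks) (suc b) _ (s≤s b≤N) refl =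
  trans (vget-suffix (suc N) (suc N) b (s≤s b≤N)) (<ᵇ-true (s≤s (m≤n+m (suc N) b)))

module Diagonals (N : ℕ) (ks : Vec ℕ N) where

  F : Subset N N
  F = ferrers {m = N} ks

  d : ℕ → ℕ
  d = diagSize F

  onDiagonal : ℕ → ℕ → ℕ → ℕ
  onDiagonal i a b = when (b + i ≡ᵇ N + a) (𝟙 (mem F a b))

  d-∑ : ∀ i → d i ≡ ∑ (range N) (λ a → ∑ (range N) (onDiagonal i a))
  d-∑ i = ∑-cong (range N) (λ a → trans (length-filterᵇ≡∑ _ (range N))
                                         (∑-cong (range N) (λ b → trans (when-∧ (mem F a b) _ 1) (when-comm (mem F a b) _ 1))))

  rowCell : ℕ → ℕ → ℕ
  rowCell i a = when ((i <ᵇ N + a) ∧ (N + a ≤ᵇ i + N)) (𝟙 (mem F a (N + a ∸ i)))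

  d-rowCell : ∀ i → d i ≡ ∑ (range N) (rowCell i)
  d-rowCell i = trans (d-∑ i) (∑-cong (range N) (λ a → ∑-range-single N i (N + a) (𝟙 ∘ mem F a)))

  ∑-onDiagonal-swap : (is : List ℕ) → ∑ is (λ i → ∑ (range N) (λ a → ∑ (range N) (onDiagonal i a)))
                                  ≡ ∑ (range N) (λ a → ∑ (range N) (λ b → ∑ is (λ i → onDiagonal i a b)))
  ∑-onDiagonal-swap is = trans (∑-swap is (range N) _) (∑-cong (range N) (λ a → ∑-swap is (range N) (λ i → onDiagonal i a)))

  ∑-row : ∀ a → a < N → IsPartition N ks → ∑ (range N) (𝟙 ∘ mem F (suc a)) ≡ entry ks (suc a)
  ∑-row a a<N valid = trans (∑-cong (range N) (λ b → cong 𝟙 (mem-ferrers ks a b a<N)))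
                            (trans (∑-suffix N (entry ks (suc a)) N (entry≤bound ks a valid a<N) ≤-refl) (m+n∸m≡n N _))

  ∑-row-prefix : ∀ a → a < N → IsPartition N ks → ∑ (range a) (𝟙 ∘ mem F (suc a)) ≡ (a + entry ks (suc a)) ∸ N
  ∑-row-prefix a a<N valid = trans (∑-cong (range a) (λ b → cong 𝟙 (mem-ferrers ks a b a<N)))
                                   (∑-suffix N (entry ks (suc a)) a (entry≤bound ks a valid a<N) (<⇒≤ a<N))

  ∑-onDiagonal : ∀ L a b → ∑ (range L) (λ i → onDiagonal i a b) ≡ when ((b <ᵇ N + a) ∧ (N + a ≤ᵇ b + L)) (𝟙 (mem F a b))
  ∑-onDiagonal L a b = trans (∑-cong (range L) (λ i → cong (λ z → when (z ≡ᵇ N + a) (𝟙 (mem F a b))) (+-comm b i)))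
                             (∑-range-single L b (N + a) (λ _ → 𝟙 (mem F a b)))

  ∑-d : IsPartition N ks → ∑ (range ((N + N) ∸ 1)) d ≡ ∑ᵥ (λ k → k) ks
  ∑-d valid = begin
    ∑ (range L) d                                                          ≡⟨ ∑-cong (range L) d-∑ ⟩
    ∑ (range L) (λ i → ∑ (range N) (λ a → ∑ (range N) (onDiagonal i a)))   ≡⟨ ∑-onDiagonal-swap (range L) ⟩
    ∑ (range N) (λ a → ∑ (range N) (λ b → ∑ (range L) (λ i → onDiagonal i a b)))
      ≡⟨ ∑-range-cong N (λ a a<N → ∑-range-cong N (λ b b<N →
           trans (∑-onDiagonal L (suc a) (suc b)) (cong (λ z → when z (𝟙 (mem F (suc a) (suc b)))) (onSomeDiagonal a b a<N b<N)))) ⟩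
    ∑ (range N) (λ a → ∑ (range N) (𝟙 ∘ mem F a))                         ≡⟨ ∑-range-cong N (λ a a<N → ∑-row a a<N valid) ⟩
    ∑ (range N) (entry ks)                                                 ≡⟨ ∑-range-entry ks (λ k → k) ⟩
    ∑ᵥ (λ k → k) ks                                                        ∎
    where
    open ≡-Reasoning
    L = (N + N) ∸ 1
    N+N≤1+L : ∀ n → n ≤ suc (n ∸ 1)
    N+N≤1+L zero    = z≤n
    N+N≤1+L (suc n) = ≤-refl
    onSomeDiagonal : ∀ a b → a < N → b < N → ((suc b <ᵇ N + suc a) ∧ (N + suc a ≤ᵇ suc b + L)) ≡ true
    onSomeDiagonal a b a<N b<N
      rewrite <ᵇ-true {suc b} {N + suc a} (≤-trans (s≤s b<N) (≤-trans (≤-reflexive (+-comm 1 N)) (+-monoʳ-≤ N (s≤s z≤n))))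
            | ≤ᵇ-true {N + suc a} {suc b + L} (≤-trans (+-monoʳ-≤ N a<N) (≤-trans (N+N≤1+L (N + N)) (s≤s (m≤n+m L b)))) = refl

  +-<ᵇ-cancelˡ : ∀ k m n → (k + m <ᵇ k + n) ≡ (m <ᵇ n)
  +-<ᵇ-cancelˡ zero    m n = refl
  +-<ᵇ-cancelˡ (suc k) m n = +-<ᵇ-cancelˡ k m n

  ∑-onLowerDiagonal : ∀ N₁ → N ≡ suc N₁ → ∀ a b → a < N → b < N →
                      ∑ (range N₁) (λ i → onDiagonal (N + i) (suc a) (suc b)) ≡ when (b <ᵇ a) (𝟙 (mem F (suc a) (suc b)))
  ∑-onLowerDiagonal N₁ N≡ a b a<N b<N = begin
    ∑ (range N₁) (λ i → when (suc b + (N + i) ≡ᵇ N + suc a) x)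
      ≡⟨ ∑-cong (range N₁) (λ i → cong (λ z → when (z ≡ᵇ N + suc a) x) (trans (sym (+-assoc (suc b) N i)) (+-comm (suc b + N) i))) ⟩
    ∑ (range N₁) (λ i → when (i + (suc b + N) ≡ᵇ N + suc a) x)
      ≡⟨ ∑-range-single N₁ (suc b + N) (N + suc a) (λ _ → x) ⟩
    when ((suc b + N <ᵇ N + suc a) ∧ (N + suc a ≤ᵇ suc b + N + N₁)) x
      ≡⟨ cong₂ (λ p q → when (p ∧ q) x) (trans (cong (_<ᵇ N + suc a) (+-comm (suc b) N)) (+-<ᵇ-cancelˡ N (suc b) (suc a))) lastRowFits ⟩
    when ((b <ᵇ a) ∧ true) x
      ≡⟨ cong (λ p → when p x) (∧-identityʳ (b <ᵇ a)) ⟩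
    when (b <ᵇ a) x ∎
    where
    open ≡-Reasoning
    x = 𝟙 (mem F (suc a) (suc b))
    lastRowFits : (N + suc a ≤ᵇ suc b + N + N₁) ≡ true
    lastRowFits = ≤ᵇ-true (≤-trans (+-monoʳ-≤ N a<N)
                                   (≤-trans (≤-reflexive (trans (cong (N +_) N≡) (+-suc N N₁))) (s≤s (+-monoˡ-≤ N₁ (m≤n+m N b)))))

  ∑-d-lower : ∀ N₁ → N ≡ suc N₁ → IsPartition N ks → ∑ (range N₁) (λ i → d (N + i)) ≡ belowDiagonal ks
  ∑-d-lower N₁ N≡ valid = begin
    ∑ (range N₁) (λ i → d (N + i))                                         ≡⟨ sym (∑-map (range N₁) (N +_) d) ⟩
    ∑ is d                                                                 ≡⟨ ∑-cong is d-∑ ⟩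
    ∑ is (λ i → ∑ (range N) (λ a → ∑ (range N) (onDiagonal i a)))         ≡⟨ ∑-onDiagonal-swap is ⟩
    ∑ (range N) (λ a → ∑ (range N) (λ b → ∑ is (λ i → onDiagonal i a b)))
      ≡⟨ ∑-range-cong N (λ a a<N → ∑-range-cong N (λ b b<N →
           trans (∑-map (range N₁) (N +_) _) (∑-onLowerDiagonal N₁ N≡ a b a<N b<N))) ⟩
    ∑ (range N) (λ a → ∑ (range N) (λ b → when (b <ᵇ a) (𝟙 (mem F a b))))
      ≡⟨ ∑-range-cong N (λ a a<N → trans (∑-range-when-< N a _ (<⇒≤ a<N)) (∑-row-prefix a a<N valid)) ⟩
    ∑ (range N) (λ a → ((a ∸ 1) + entry ks a) ∸ N)                        ≡⟨ ∑-range-entryᵢ ks (λ a k → ((a ∸ 1) + k) ∸ N) ⟩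
    ∑ᵢ (λ a k → ((a ∸ 1) + k) ∸ N) ks                                      ≡⟨ belowDiagonal-∑ᵢ ks ⟩
    belowDiagonal ks                                                   ∎
    where
    open ≡-Reasoning
    is = map (N +_) (range N₁)

  d-first : ∀ N₁ → N ≡ suc N₁ → AllPositive ks → d 1 ≡ 1
  d-first N₁ N≡ pos = begin
    d 1                                                  ≡⟨ d-rowCell 1 ⟩
    ∑ (range N) (rowCell 1)                              ≡⟨ cong (λ z → ∑ (range z) (rowCell 1)) N≡ ⟩
    ∑ (range (suc N₁)) (rowCell 1)                       ≡⟨ ∑-range-sucˡ N₁ (rowCell 1) ⟩
    rowCell 1 1 + ∑ (range N₁) (rowCell 1 ∘ suc)         ≡⟨ cong₂ _+_ corner (trans (∑-range-cong N₁ {g = λ _ → 0} (λ a _ → offDiagonal a)) (∑-zero (range N₁))) ⟩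
    1 + 0                                                ∎
    where
    open ≡-Reasoning
    corner : rowCell 1 1 ≡ 1
    corner rewrite <ᵇ-true {1} {N + 1} (≤-trans (s≤s (subst (1 ≤_) (sym N≡) (s≤s z≤n))) (≤-reflexive (+-comm 1 N)))
                 | ≤ᵇ-true {N + 1} {1 + N} (≤-reflexive (+-comm N 1))
                 | m+n∸n≡m N 1 | mem-ferrers-last N ks 0 (subst (0 <_) (sym N≡) z<s) pos = refl
    offDiagonal : ∀ a → rowCell 1 (suc (suc a)) ≡ 0
    offDiagonal a rewrite ≤ᵇ-false {N + suc (suc a)} {1 + N} (subst (_< N + suc (suc a)) (+-comm N 1) (+-monoʳ-< N (s≤s (s≤s z≤n))))
      = ∧-zeroʳ-when (1 <ᵇ N + suc (suc a))
      where
      ∧-zeroʳ-when : ∀ b → when (b ∧ false) (𝟙 (mem F (suc (suc a)) (N + suc (suc a) ∸ 1))) ≡ 0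
      ∧-zeroʳ-when b rewrite ∧-zeroʳ b = refl

  d-≥2 : ∀ N₁ → N ≡ suc N₁ → AllPositive ks → entry ks 1 ≡ N → ∀ i → suc (suc i) ≤ N → 2 ≤ d (suc (suc i))
  d-≥2 N₁ N≡ pos k₁≡N i i+2≤N =
    subst (2 ≤_) (sym (trans (d-rowCell (suc (suc i))) (trans (cong (λ z → ∑ (range z) (rowCell (suc (suc i)))) N≡) (∑-range-sucˡ N₁ _))))
      (subst (λ z → 2 ≤ z + ∑ (range N₁) (rowCell (suc (suc i)) ∘ suc)) (sym firstRow)
        (s≤s (subst (_≤ ∑ (range N₁) (rowCell (suc (suc i)) ∘ suc)) lastColumn (∑-range-≥-term N₁ i _ i<N₁))))
    where
    j = suc (suc i)
    i<N₁ : i < N₁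
    i<N₁ = ≤-pred (subst (j ≤_) N≡ i+2≤N)
    firstRow : rowCell j 1 ≡ 1
    firstRow rewrite <ᵇ-true {j} {N + 1} (≤-trans (s≤s i+2≤N) (≤-reflexive (+-comm 1 N)))
                   | ≤ᵇ-true {N + 1} {j + N} (≤-trans (≤-reflexive (+-comm N 1)) (+-monoˡ-≤ N (s≤s z≤n)))
                   | mem-ferrers-first N ks (N + 1 ∸ j) (m<n⇒0<n∸m (≤-trans (s≤s i+2≤N) (≤-reflexive (+-comm 1 N))))
                       (≤-trans (∸-monoʳ-≤ (N + 1) (s≤s z≤n)) (≤-reflexive (m+n∸n≡m N 1))) k₁≡N = refl
    lastColumn : rowCell j j ≡ 1
    lastColumn rewrite <ᵇ-true {j} {N + j} (m<n+m j (≤-trans (s≤s z≤n) (≤-trans (s≤s z≤n) i+2≤N)))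
                     | ≤ᵇ-true {N + j} {j + N} (≤-reflexive (+-comm N j))
                     | m+n∸n≡m N j | mem-ferrers-last N ks (suc i) i+2≤N pos = refl

-- The MDS condition for d = 3

-- κ = S ∸ max Aⱼ and the diagonal bound is S ∸ (P + Y); the maximum exceeds A₁ = P by one exactly
-- when A₀ or A₂ does.
module _ {S κ₀ κ₁ κ₂ A₀ A₂ P Y δ : ℕ} (κ₀+A₀ : κ₀ + A₀ ≡ S) (κ₁+P : κ₁ + P ≡ S) (κ₂+A₂ : κ₂ + A₂ ≡ S)
         (δ+P+Y : δ + (P + Y) ≡ S) (A₀≤1+P : A₀ ≤ suc P) (A₂≤1+P : A₂ ≤ suc P) where

  private
    c : ℕ
    c = 𝟙 ((A₀ ≡ᵇ suc P) ∨ (A₂ ≡ᵇ suc P))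

    complement : ∀ {a b} → a + b ≡ S → a ≡ S ∸ b
    complement {a} {b} a+b = trans (sym (m+n∸n≡m a b)) (cong (_∸ b) a+b)

    max-A : A₀ ⊔ (P ⊔ (A₂ ⊔ A₀)) ≡ P + c
    max-A with A₀ ≟ suc P | A₂ ≟ suc P
    ... | yes refl | _ rewrite ≡ᵇ-true {A₀} refl | m≤n⇒m⊔n≡n A₂≤1+P | m≤n⇒m⊔n≡n (n≤1+n P) | ⊔-idem A₀ = +-comm 1 P
    ... | no A₀≢ | yes refl rewrite ≡ᵇ-false A₀≢ | ≡ᵇ-true {A₂} refl
                                  | m≥n⇒m⊔n≡m A₀≤1+P | m≤n⇒m⊔n≡n (n≤1+n P) | m≤n⇒m⊔n≡n A₀≤1+P = +-comm 1 P
    ... | no A₀≢ | no A₂≢ rewrite ≡ᵇ-false A₀≢ | ≡ᵇ-false A₂≢ =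
      trans (≤-antisym (⊔-lub A₀≤P (⊔-lub ≤-refl (⊔-lub A₂≤P A₀≤P))) (≤-trans (m≤m⊔n P _) (m≤n⊔m A₀ _)))
            (sym (+-identityʳ P))
      where
      A₀≤P = ≤-pred (≤∧≢⇒< A₀≤1+P A₀≢)
      A₂≤P = ≤-pred (≤∧≢⇒< A₂≤1+P A₂≢)

    kappa-eq : κ₀ ⊓ (κ₁ ⊓ (κ₂ ⊓ κ₀)) ≡ S ∸ (P + c)
    kappa-eq = begin
      κ₀ ⊓ (κ₁ ⊓ (κ₂ ⊓ κ₀))                                  ≡⟨ cong₂ (λ x y → x ⊓ (κ₁ ⊓ y)) (complement κ₀+A₀)
                                                                    (cong₂ _⊓_ (complement κ₂+A₂) (complement κ₀+A₀)) ⟩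
      (S ∸ A₀) ⊓ (κ₁ ⊓ ((S ∸ A₂) ⊓ (S ∸ A₀)))                ≡⟨ cong (λ x → (S ∸ A₀) ⊓ (x ⊓ ((S ∸ A₂) ⊓ (S ∸ A₀)))) (complement κ₁+P) ⟩
      (S ∸ A₀) ⊓ ((S ∸ P) ⊓ ((S ∸ A₂) ⊓ (S ∸ A₀)))           ≡⟨ sym (cong (λ x → (S ∸ A₀) ⊓ ((S ∸ P) ⊓ x)) (∸-distribˡ-⊔-⊓ S A₂ A₀)) ⟩
      (S ∸ A₀) ⊓ ((S ∸ P) ⊓ (S ∸ (A₂ ⊔ A₀)))                 ≡⟨ sym (cong ((S ∸ A₀) ⊓_) (∸-distribˡ-⊔-⊓ S P (A₂ ⊔ A₀))) ⟩
      (S ∸ A₀) ⊓ (S ∸ (P ⊔ (A₂ ⊔ A₀)))                       ≡⟨ sym (∸-distribˡ-⊔-⊓ S A₀ (P ⊔ (A₂ ⊔ A₀))) ⟩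
      S ∸ (A₀ ⊔ (P ⊔ (A₂ ⊔ A₀)))                             ≡⟨ cong (S ∸_) max-A ⟩
      S ∸ (P + c)                                            ∎
      where open ≡-Reasoning

    bounded : ∀ a b → a + b ≡ S → b ≤ S
    bounded a b a+b = subst (b ≤_) a+b (m≤n+m b a)

    P+c≤S : P + c ≤ S
    P+c≤S = subst (_≤ S) max-A (⊔-lub (bounded κ₀ A₀ κ₀+A₀) (⊔-lub (bounded κ₁ P κ₁+P) (⊔-lub (bounded κ₂ A₂ κ₂+A₂) (bounded κ₀ A₀ κ₀+A₀))))

  kappa≡ᵇbound : (κ₀ ⊓ (κ₁ ⊓ (κ₂ ⊓ κ₀)) ≡ᵇ δ) ≡ (Y ≡ᵇ c)
  kappa≡ᵇbound = ≡ᵇ-cong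
    (λ κ≡δ → sym (+-cancelˡ-≡ P c Y (∸-cancelˡ-≡ P+c≤S (bounded δ (P + Y) δ+P+Y)
                                    (trans (sym kappa-eq) (trans κ≡δ (complement δ+P+Y))))))
    (λ Y≡c → trans kappa-eq (sym (trans (complement δ+P+Y) (cong (λ y → S ∸ (P + y)) Y≡c))))

∸2+⊓2 : ∀ k → (k ∸ 2) + (k ⊓ 2) ≡ k
∸2+⊓2 k = trans (+-comm (k ∸ 2) (k ⊓ 2)) (trans (cong (_+ (k ∸ 2)) (⊓-comm k 2)) (m⊓n+n∸m≡n 2 k))

+-⊓2 : ∀ a b → (a + b) ⊓ 2 ≡ ((a ⊓ 2) + (b ⊓ 2)) ⊓ 2
+-⊓2 zero          zero          = refl
+-⊓2 zero          (suc zero)    = refl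
+-⊓2 zero          (suc (suc b)) rewrite ⊓-zeroʳ b = refl
+-⊓2 (suc zero)    zero          = refl
+-⊓2 (suc zero)    (suc zero)    = refl
+-⊓2 (suc zero)    (suc (suc b)) = refl
+-⊓2 (suc (suc a)) b             rewrite ⊓-zeroʳ (a + b) | ⊓-zeroʳ (a ⊓ 0 + b ⊓ 2) = refl

∑-⊓2 : {A : Set} (xs : List A) (f : A → ℕ) → ∑ xs (λ x → f x ⊓ 2) ⊓ 2 ≡ ∑ xs f ⊓ 2
∑-⊓2 []       f = refl
∑-⊓2 (x ∷ xs) f = begin
  (f x ⊓ 2 + ∑ xs (λ x → f x ⊓ 2)) ⊓ 2           ≡⟨ +-⊓2 (f x ⊓ 2) _ ⟩
  ((f x ⊓ 2) ⊓ 2 + ∑ xs (λ x → f x ⊓ 2) ⊓ 2) ⊓ 2 ≡⟨ cong₂ (λ y z → (y + z) ⊓ 2) (⊓-assoc (f x) 2 2) (∑-⊓2 xs f) ⟩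
  (f x ⊓ 2 + ∑ xs f ⊓ 2) ⊓ 2                     ≡⟨ sym (+-⊓2 (f x) (∑ xs f)) ⟩
  (f x + ∑ xs f) ⊓ 2                             ∎
  where open ≡-Reasoning

⊓2-≡ᵇ-𝟙 : ∀ x b → (x ⊓ 2 ≡ᵇ 𝟙 b) ≡ (x ≡ᵇ 𝟙 b)
⊓2-≡ᵇ-𝟙 zero          b     = refl
⊓2-≡ᵇ-𝟙 (suc zero)    b     = refl
⊓2-≡ᵇ-𝟙 (suc (suc x)) true  = refl
⊓2-≡ᵇ-𝟙 (suc (suc x)) false = refl

∑ᵥ-+ : ∀ {n} (ks : Vec ℕ n) (f g : ℕ → ℕ) → ∑ᵥ (λ k → f k + g k) ks ≡ ∑ᵥ f ks + ∑ᵥ g ks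
∑ᵥ-+ []       f g = refl
∑ᵥ-+ (k ∷ ks) f g = trans (cong (f k + g k +_) (∑ᵥ-+ ks f g)) (+-interchange (f k) (g k) (∑ᵥ f ks) (∑ᵥ g ks))

∑ᵥ-∸1 : ∀ {n} (ks : Vec ℕ n) → AllPositive ks → ∑ᵥ (_∸ 1) ks + n ≡ ∑ᵥ (λ k → k) ks
∑ᵥ-∸1 []                 _   = refl
∑ᵥ-∸1 {suc n} (suc k ∷ ks) pos =
  trans (+-assoc k _ (suc n)) (trans (cong (k +_) (trans (+-suc _ n) (cong suc (∑ᵥ-∸1 ks pos)))) (+-suc k _))

∑ᵥ-⊓2≤ : ∀ {n} (ks : Vec ℕ n) → ∑ᵥ (_⊓ 2) ks ≤ 2 * n
∑ᵥ-⊓2≤ []               = z≤n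
∑ᵥ-⊓2≤ {suc n} (k ∷ ks) = ≤-trans (+-mono-≤ (m⊓n≤n k 2) (∑ᵥ-⊓2≤ ks)) (≤-reflexive (sym (*-suc 2 n)))

allAtLeast₂ : {n : ℕ} → Vec ℕ n → Bool
allAtLeast₂ []       = true
allAtLeast₂ (k ∷ ks) = (2 ≤ᵇ k) ∧ allAtLeast₂ ks

∑ᵥ-⊓2≡ᵇ : ∀ {n} (ks : Vec ℕ n) → (∑ᵥ (_⊓ 2) ks ≡ᵇ 2 * n) ≡ allAtLeast₂ ks
∑ᵥ-⊓2≡ᵇ []               = refl
∑ᵥ-⊓2≡ᵇ {suc n} (k ∷ ks) rewrite *-suc 2 n = head k
  where
  s≤2n = ∑ᵥ-⊓2≤ ks
  head : ∀ k → (k ⊓ 2 + ∑ᵥ (_⊓ 2) ks ≡ᵇ 2 + 2 * n) ≡ ((2 ≤ᵇ k) ∧ allAtLeast₂ ks)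
  head zero          = ≡ᵇ-false (<⇒≢ (≤-trans (s≤s s≤2n) (n≤1+n _)))
  head (suc zero)    = ≡ᵇ-false (<⇒≢ (s≤s (s≤s s≤2n)))
  head (suc (suc k)) rewrite ⊓-zeroʳ k = ∑ᵥ-⊓2≡ᵇ ks

module MDSCharacterisation (N′ k₂ : ℕ) (ks : Vec ℕ N′) where
  private
    N = suc (suc N′)
    v : Vec ℕ N
    v = N ∷ k₂ ∷ ks
    open Diagonals N v
    total = ∑ᵥ (λ k → k) v
    κ₀ = ∑ᵥ (_∸ 2) v
    κ₁ = ∑ᵥ (_∸ 1) (k₂ ∷ ks)
    κ₂ = ∑ᵥ (λ k → k) ks
    A₀ = ∑ᵥ (_⊓ 2) v
    A₂ = N + k₂
    P = N + suc N′
    Y = ∑ (range (suc N′)) (λ i → d (N + i) ⊓ 2)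
    2N≡1+P : N + N ≡ suc P
    2N≡1+P = +-suc N (suc N′)
    2*N≡1+P : 2 * N ≡ suc P
    2*N≡1+P = trans (cong (N +_) (+-identityʳ N)) 2N≡1+P

    κ₀+A₀ : κ₀ + A₀ ≡ total
    κ₀+A₀ = trans (sym (∑ᵥ-+ v (_∸ 2) (_⊓ 2))) (∑ᵥ-cong v ∸2+⊓2)

    κ₂+A₂ : κ₂ + A₂ ≡ total
    κ₂+A₂ = trans (+-comm κ₂ (N + k₂)) (+-assoc N k₂ κ₂)

    A₀≡ᵇ1+P : (A₀ ≡ᵇ suc P) ≡ allAtLeast₂ (k₂ ∷ ks)
    A₀≡ᵇ1+P = trans (cong (A₀ ≡ᵇ_) (sym 2*N≡1+P)) (∑ᵥ-⊓2≡ᵇ v)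

    A₂≡ᵇ1+P : (A₂ ≡ᵇ suc P) ≡ (k₂ ≡ᵇ N)
    A₂≡ᵇ1+P = trans (cong (A₂ ≡ᵇ_) (sym 2N≡1+P)) (+-≡ᵇ-cancelˡ N k₂ N)

  module _ (valid : IsPartition N v) (pos : AllPositive v) where
    private
      -- row 1 and the rest of column N account for ∑ᵢ≤N min(|Dᵢ ∩ F|, 2) = 2N - 1
      ∑-d⊓2-upper : ∑ (range N) (λ i → d i ⊓ 2) ≡ P
      ∑-d⊓2-upper = begin
        ∑ (range N) (λ i → d i ⊓ 2)                         ≡⟨ ∑-range-sucˡ (suc N′) (λ i → d i ⊓ 2) ⟩
        d 1 ⊓ 2 + ∑ (range (suc N′)) (λ i → d (suc i) ⊓ 2)
          ≡⟨ cong₂ _+_ (cong (_⊓ 2) (d-first (suc N′) refl pos))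
                       (∑-range-cong (suc N′) {g = λ _ → 2} (λ i i< → m≥n⇒m⊓n≡n (d-≥2 (suc N′) refl pos refl i (s≤s i<)))) ⟩
        1 + ∑ (range (suc N′)) (λ _ → 2)                    ≡⟨ cong (1 +_) (∑-range-const (suc N′) 2) ⟩
        1 + suc N′ * 2                                      ≡⟨ arith N′ ⟩
        P                                                   ∎
        where
        open ≡-Reasoning
        arith : ∀ n → 1 + suc n * 2 ≡ suc (suc n) + suc n
        arith = solve-∀

      δ+P+Y : diagBound F 3 + (P + Y) ≡ total
      δ+P+Y = begin
        diagBound F 3 + (P + Y)                                 ≡⟨ cong (λ z → diagBound F 3 + (z + Y)) (sym ∑-d⊓2-upper) ⟩
        diagBound F 3 + (∑ (range N) (λ i → d i ⊓ 2) + Y)       ≡⟨ cong (diagBound F 3 +_) (sym (∑-range-+ N (suc N′) (λ i → d i ⊓ 2))) ⟩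
        diagBound F 3 + ∑ (range (N + suc N′)) (λ i → d i ⊓ 2)  ≡⟨ cong (λ z → ∑ (range z) (λ i → d i ∸ 2) + ∑ (range (N + suc N′)) (λ i → d i ⊓ 2)) L≡ ⟩
        ∑ (range (N + suc N′)) (λ i → d i ∸ 2) + ∑ (range (N + suc N′)) (λ i → d i ⊓ 2)
          ≡⟨ trans (sym (∑-+ (range (N + suc N′)) (λ i → d i ∸ 2) (λ i → d i ⊓ 2))) (∑-cong (range (N + suc N′)) (∸2+⊓2 ∘ d)) ⟩
        ∑ (range (N + suc N′)) d                                ≡⟨ cong (λ z → ∑ (range z) d) (sym L≡) ⟩
        ∑ (range ((N + N) ∸ 1)) d                               ≡⟨ ∑-d valid ⟩
        total                                                   ∎
        where
        open ≡-Reasoning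
        L≡ : (N + N) ∸ 1 ≡ N + suc N′
        L≡ = cong (_∸ 1) 2N≡1+P

      κ₁+P : κ₁ + P ≡ total
      κ₁+P = begin
        κ₁ + (N + suc N′)            ≡⟨ cong (κ₁ +_) (+-comm N (suc N′)) ⟩
        κ₁ + (suc N′ + N)            ≡⟨ sym (+-assoc κ₁ (suc N′) N) ⟩
        κ₁ + suc N′ + N              ≡⟨ cong (_+ N) (∑ᵥ-∸1 (k₂ ∷ ks) pos) ⟩
        ∑ᵥ (λ k → k) (k₂ ∷ ks) + N   ≡⟨ +-comm _ N ⟩
        total                        ∎
        where open ≡-Reasoning

      A₀≤1+P : A₀ ≤ suc P
      A₀≤1+P = ≤-trans (∑ᵥ-⊓2≤ v) (≤-reflexive 2*N≡1+P)

      A₂≤1+P : A₂ ≤ suc P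
      A₂≤1+P = ≤-trans (+-monoʳ-≤ N (proj₁ (proj₂ valid))) (≤-reflexive 2N≡1+P)

      Y⊓2 : Y ⊓ 2 ≡ belowDiagonal v ⊓ 2
      Y⊓2 = trans (∑-⊓2 (range (suc N′)) (λ i → d (N + i))) (cong (_⊓ 2) (∑-d-lower (suc N′) refl valid))

      kappa-ferrers : kappa F 3 ≡ κ₀ ⊓ (κ₁ ⊓ (κ₂ ⊓ κ₀))
      kappa-ferrers = cong₃ (λ x y z → x ⊓ (y ⊓ (z ⊓ x)))
        (kappa₀-ferrers N′ v valid) (kappa₁-ferrers N′ (k₂ ∷ ks) (proj₂ (proj₂ valid))) (kappa₂-ferrers N′ k₂ ks (proj₂ (proj₂ valid)))
        where
        cong₃ : ∀ (f : ℕ → ℕ → ℕ → ℕ) {x x′ y y′ z z′} → x ≡ x′ → y ≡ y′ → z ≡ z′ → f x y z ≡ f x′ y′ z′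
        cong₃ f refl refl refl = refl

    isMDSConstructible-ferrers : isMDSConstructible F 3 ≡ (belowDiagonal v ≡ᵇ 𝟙 (allAtLeast₂ (k₂ ∷ ks) ∨ (k₂ ≡ᵇ N)))
    isMDSConstructible-ferrers = begin
      kappa F 3 ≡ᵇ diagBound F 3                             ≡⟨ cong (_≡ᵇ diagBound F 3) kappa-ferrers ⟩
      κ₀ ⊓ (κ₁ ⊓ (κ₂ ⊓ κ₀)) ≡ᵇ diagBound F 3                 ≡⟨ kappa≡ᵇbound κ₀+A₀ κ₁+P κ₂+A₂ δ+P+Y A₀≤1+P A₂≤1+P ⟩
      Y ≡ᵇ 𝟙 ((A₀ ≡ᵇ suc P) ∨ (A₂ ≡ᵇ suc P))                 ≡⟨ cong₂ (λ x y → Y ≡ᵇ 𝟙 (x ∨ y)) A₀≡ᵇ1+P A₂≡ᵇ1+P ⟩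
      Y ≡ᵇ 𝟙 c                                               ≡⟨ sym (⊓2-≡ᵇ-𝟙 Y c) ⟩
      Y ⊓ 2 ≡ᵇ 𝟙 c                                           ≡⟨ cong (_≡ᵇ 𝟙 c) Y⊓2 ⟩
      belowDiagonal v ⊓ 2 ≡ᵇ 𝟙 c                             ≡⟨ ⊓2-≡ᵇ-𝟙 (belowDiagonal v) c ⟩
      belowDiagonal v ≡ᵇ 𝟙 c                                 ∎
      where
      open ≡-Reasoning
      c = allAtLeast₂ (k₂ ∷ ks) ∨ (k₂ ≡ᵇ N)

-- Catalan numbers

-- Every entry k followed by j further entries satisfies lo ≤ k ≤ ceiling j.
boundedBy : (ℕ → ℕ) → ℕ → {n : ℕ} → Vec ℕ n → Bool
boundedBy ceiling lo []               = true
boundedBy ceiling lo {suc n} (k ∷ ks) = (k ≤ᵇ ceiling n) ∧ ((lo ≤ᵇ k) ∧ boundedBy ceiling lo ks)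

countBounded : (ℕ → ℕ) → ℕ → (L m : ℕ) → ℕ
countBounded ceiling lo L m = ∑ (partitions L m) (𝟙 ∘ boundedBy ceiling lo)

countBounded≤ : (ℕ → ℕ) → ℕ → (L m w : ℕ) → ℕ
countBounded≤ ceiling lo L m w = ∑ (partitions L m) (λ ks → when (head₀ ks ≤ᵇ w) (𝟙 (boundedBy ceiling lo ks)))

countBounded≤-full : ∀ ceiling lo L m w → m ≤ w → countBounded≤ ceiling lo L m w ≡ countBounded ceiling lo L m
countBounded≤-full ceiling lo L m w m≤w = ∑-cong-All (partitions L m) (partitions-valid L m)
  (λ ks valid → cong (λ b → when b (𝟙 (boundedBy ceiling lo ks))) (≤ᵇ-true (≤-trans (head₀≤bound ks valid) m≤w)))

module _ (ceiling : ℕ → ℕ) (lo L m : ℕ) where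

  private
    admissible : ℕ → Bool
    admissible x = (x ≤ᵇ m) ∧ ((x ≤ᵇ ceiling L) ∧ (lo ≤ᵇ x))

    rearrange : ∀ a b p q r → when (a ∧ b) (𝟙 (p ∧ (q ∧ r))) ≡ when (b ∧ (p ∧ q)) (when a (𝟙 r))
    rearrange true  true  true  true  r = refl
    rearrange true  true  true  false r = refl
    rearrange true  true  false q     r = refl
    rearrange true  false true  true  r = refl
    rearrange true  false true  false r = refl
    rearrange true  false false q     r = refl
    rearrange false true  true  true  r = refl
    rearrange false true  true  false r = refl
    rearrange false true  false q     r = refl
    rearrange false false true  true  r = refl
    rearrange false false true  false r = refl
    rearrange false false false q     r = refl

  ∑-boundedBy-head≡ : ∀ x → ∑ (partitions (suc L) m) (λ ks → when (head₀ ks ≡ᵇ x) (𝟙 (boundedBy ceiling lo ks)))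
                            ≡ when (admissible x) (countBounded≤ ceiling lo L m x)
  ∑-boundedBy-head≡ x = begin
    ∑ (partitions (suc L) m) f                                                  ≡⟨ ∑-partitions-∷ L m f ⟩
    ∑ (partitions L m) (λ ks → ∑ (fromTo (head₀ ks) m) (λ k → f (k ∷ ks)))      ≡⟨ ∑-cong (partitions L m) (λ ks → ∑-fromTo-single (head₀ ks) m x _) ⟩
    ∑ (partitions L m) (λ ks → when ((head₀ ks ≤ᵇ x) ∧ (x ≤ᵇ m)) (𝟙 ((x ≤ᵇ ceiling L) ∧ ((lo ≤ᵇ x) ∧ boundedBy ceiling lo ks))))
      ≡⟨ ∑-cong (partitions L m) (λ ks → rearrange (head₀ ks ≤ᵇ x) (x ≤ᵇ m) (x ≤ᵇ ceiling L) (lo ≤ᵇ x) (boundedBy ceiling lo ks)) ⟩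
    ∑ (partitions L m) (λ ks → when (admissible x) (when (head₀ ks ≤ᵇ x) (𝟙 (boundedBy ceiling lo ks))))
      ≡⟨ ∑-when (partitions L m) _ _ ⟩
    when (admissible x) (countBounded≤ ceiling lo L m x) ∎
    where
    open ≡-Reasoning
    f : Vec ℕ (suc L) → ℕ
    f ks = when (head₀ ks ≡ᵇ x) (𝟙 (boundedBy ceiling lo ks))

  countBounded≤-suc : ∀ w → countBounded≤ ceiling lo (suc L) m (suc w)
                            ≡ countBounded≤ ceiling lo (suc L) m w + when (admissible (suc w)) (countBounded≤ ceiling lo L m (suc w))
  countBounded≤-suc w =
    trans (∑-cong (partitions (suc L) m) (λ ks → ≤ᵇ-suc (head₀ ks) _))
          (trans (∑-+ (partitions (suc L) m) _ _) (cong (countBounded≤ ceiling lo (suc L) m w +_) (∑-boundedBy-head≡ (suc w))))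
    where
    ≤ᵇ-suc : ∀ k x → when (k ≤ᵇ suc w) x ≡ when (k ≤ᵇ w) x + when (k ≡ᵇ suc w) x
    ≤ᵇ-suc k x with k ≤? w
    ... | yes k≤w rewrite ≤ᵇ-true (m≤n⇒m≤1+n k≤w) | ≤ᵇ-true k≤w | ≡ᵇ-false (<⇒≢ (s≤s k≤w)) = sym (+-identityʳ x)
    ... | no k≰w with k ≟ suc w
    ...   | yes refl rewrite ≤ᵇ-true {suc w} ≤-refl | ≤ᵇ-false {suc w} {w} ≤-refl | ≡ᵇ-true {suc w} refl = refl
    ...   | no k≢    rewrite ≤ᵇ-false (≤∧≢⇒< (≰⇒> k≰w) (≢-sym k≢)) | ≤ᵇ-false (≰⇒> k≰w) | ≡ᵇ-false k≢ = refl

  countBounded≤-zero : countBounded≤ ceiling lo (suc L) m 0 ≡ when (admissible 0) (countBounded≤ ceiling lo L m 0)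
  countBounded≤-zero =
    trans (∑-cong (partitions (suc L) m) (λ ks → cong (λ b → when b (𝟙 (boundedBy ceiling lo ks))) (≤ᵇ0 (head₀ ks))))
          (∑-boundedBy-head≡ 0)
    where
    ≤ᵇ0 : ∀ k → (k ≤ᵇ 0) ≡ (k ≡ᵇ 0)
    ≤ᵇ0 zero    = refl
    ≤ᵇ0 (suc k) = refl

ceiling₂ : ℕ → ℕ
ceiling₂ zero    = 2
ceiling₂ (suc n) = suc (suc n)

countUnder≤ countUnder₂≤ : (L m w : ℕ) → ℕ
countUnder≤  = countBounded≤ suc 1
countUnder₂≤ = countBounded≤ ceiling₂ 2

when-∧-∧false : ∀ a b x → when (a ∧ (b ∧ false)) x ≡ 0
when-∧-∧false true  true  x = refl
when-∧-∧false true  false x = refl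
when-∧-∧false false b     x = refl

countUnder≤-zero : ∀ L m → countUnder≤ (suc L) m 0 ≡ 0
countUnder≤-zero L m = countBounded≤-zero suc 1 L m

countUnder₂≤-zero : ∀ L m → countUnder₂≤ (suc L) m 0 ≡ 0
countUnder₂≤-zero L m = countBounded≤-zero ceiling₂ 2 L m

C-pred : ℕ → ℕ → ℕ
C-pred n zero    = 0
C-pred n (suc u) = n C u

pascal : ∀ n k → suc n C suc k ≡ n C k + n C suc k
pascal n k = sym (nCk+nC[k+1]≡[n+1]C[k+1] n k)

C-pred-pascal : ∀ n u → suc n C u ≡ C-pred n u + n C u
C-pred-pascal n zero    = refl
C-pred-pascal n (suc u) = pascal n u

countUnder≤-saturated : ∀ L m d → countUnder≤ (suc L) m (suc L + d) ≡ countUnder≤ (suc L) m (suc L)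
countUnder≤-saturated L m zero    = cong (countUnder≤ (suc L) m) (+-identityʳ (suc L))
countUnder≤-saturated L m (suc d) = begin
  countUnder≤ (suc L) m (suc L + suc d)                    ≡⟨ cong (countUnder≤ (suc L) m) (+-suc (suc L) d) ⟩
  countUnder≤ (suc L) m (suc (suc L + d))                  ≡⟨ countBounded≤-suc suc 1 L m (suc L + d) ⟩
  countUnder≤ (suc L) m (suc L + d) + when ((suc (suc L + d) ≤ᵇ m) ∧ ((suc (suc L + d) ≤ᵇ suc L) ∧ true)) (countUnder≤ L m (suc (suc L + d)))
    ≡⟨ cong₂ _+_ (countUnder≤-saturated L m d)
                 (trans (cong (λ b → when ((suc (suc L + d) ≤ᵇ m) ∧ (b ∧ true)) (countUnder≤ L m (suc (suc L + d))))
                              (≤ᵇ-false {suc (suc L + d)} {suc L} (s≤s (s≤s (m≤m+n L d)))))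
                        (when-∧-∧false (suc (suc L + d) ≤ᵇ m) false _)) ⟩
  countUnder≤ (suc L) m (suc L) + 0                        ≡⟨ +-identityʳ _ ⟩
  countUnder≤ (suc L) m (suc L)                            ∎
  where open ≡-Reasoning

countUnder≤-diagonal : ∀ u m → countUnder≤ (suc u) m (suc (suc u)) ≡ countUnder≤ (suc u) m (suc u)
countUnder≤-diagonal u m = trans (cong (countUnder≤ (suc u) m) (+-comm 1 (suc u))) (countUnder≤-saturated u m 1)

countUnder≤-step : ∀ m L w → w ≤ L → suc L ≤ m → countUnder≤ (suc L) m (suc w) ≡ countUnder≤ (suc L) m w + countUnder≤ L m (suc w)
countUnder≤-step m L w w≤L L<m = trans (countBounded≤-suc suc 1 L m w) (cong (countUnder≤ (suc L) m w +_) admissible)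
  where
  admissible : when ((suc w ≤ᵇ m) ∧ ((suc w ≤ᵇ suc L) ∧ true)) (countUnder≤ L m (suc w)) ≡ countUnder≤ L m (suc w)
  admissible rewrite ≤ᵇ-true (≤-trans (s≤s w≤L) L<m) | ≤ᵇ-true (s≤s w≤L) = refl

countUnder≤-ballot : ∀ m L u → L + 1 ≤ m → u ≤ L → countUnder≤ L m (suc u) + C-pred (L + u) u ≡ (L + u) C u
countUnder≤-ballot m zero    zero    _   _ = refl
countUnder≤-ballot m (suc L) zero    L<m _ = begin
  countUnder≤ (suc L) m 1 + 0                  ≡⟨ +-identityʳ _ ⟩
  countUnder≤ (suc L) m 1                      ≡⟨ countUnder≤-step m L 0 z≤n (≤-trans (n≤1+n (suc L)) (subst (_≤ m) (+-comm (suc L) 1) L<m)) ⟩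
  countUnder≤ (suc L) m 0 + countUnder≤ L m 1  ≡⟨ cong (_+ countUnder≤ L m 1) (countUnder≤-zero L m) ⟩
  countUnder≤ L m 1                            ≡⟨ sym (+-identityʳ _) ⟩
  countUnder≤ L m 1 + 0                        ≡⟨ countUnder≤-ballot m L 0 (≤-trans (n≤1+n _) L<m) z≤n ⟩
  1                                            ∎
  where open ≡-Reasoning
countUnder≤-ballot m (suc L) (suc u) L<m u<1+L with m≤n⇒m<n∨m≡n (≤-pred u<1+L)
... | inj₁ u<L = begin
  countUnder≤ (suc L) m (suc (suc u)) + C-pred (suc n) (suc u)
    ≡⟨ cong₂ _+_ (countUnder≤-step m L (suc u) u<L (≤-trans (n≤1+n (suc L)) (subst (_≤ m) (+-comm (suc L) 1) L<m))) (C-pred-pascal n u) ⟩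
  (countUnder≤ (suc L) m (suc u) + countUnder≤ L m (suc (suc u))) + (C-pred n u + n C u)
    ≡⟨ +-interchange (countUnder≤ (suc L) m (suc u)) _ (C-pred n u) (n C u) ⟩
  (countUnder≤ (suc L) m (suc u) + C-pred n u) + (countUnder≤ L m (suc (suc u)) + n C u)
    ≡⟨ cong₂ _+_ (subst (λ z → countUnder≤ (suc L) m (suc u) + C-pred z u ≡ z C u) (sym (+-suc L u))
                         (countUnder≤-ballot m (suc L) u L<m (≤-trans (n≤1+n u) u<1+L)))
                 (countUnder≤-ballot m L (suc u) (≤-trans (n≤1+n _) L<m) u<L) ⟩
  n C u + n C suc u                            ≡⟨ sym (pascal n u) ⟩
  suc n C suc u                                ∎
  where
  open ≡-Reasoning
  n = L + suc u
... | inj₂ refl = begin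
  countUnder≤ (suc u) m (suc (suc u)) + C-pred (suc n) (suc u)
    ≡⟨ cong₂ _+_ (countUnder≤-diagonal u m) (C-pred-pascal n u) ⟩
  countUnder≤ (suc u) m (suc u) + (C-pred n u + n C u)    ≡⟨ sym (+-assoc _ (C-pred n u) (n C u)) ⟩
  (countUnder≤ (suc u) m (suc u) + C-pred n u) + n C u
    ≡⟨ cong (_+ n C u) (subst (λ z → countUnder≤ (suc u) m (suc u) + C-pred z u ≡ z C u) (sym (+-suc u u))
                               (countUnder≤-ballot m (suc u) u L<m (n≤1+n u))) ⟩
  n C u + n C u                                ≡⟨ cong (n C u +_) middle ⟩
  n C u + n C suc u                            ≡⟨ sym (pascal n u) ⟩
  suc n C suc u                                ∎
  where
  open ≡-Reasoning
  n = u + suc u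
  middle : n C u ≡ n C suc u
  middle = sym (trans (nCk≡nC[n∸k] (m≤n+m (suc u) u)) (cong (n C_) (m+n∸n≡m u (suc u))))

C-absorption : ∀ n k → (suc n C suc k) * suc k ≡ (n C k) * suc n
C-absorption zero    zero    = refl
C-absorption zero    (suc k) = refl
C-absorption (suc n) zero    = begin
  (suc (suc n) C 1) * 1      ≡⟨ cong (_* 1) (pascal (suc n) 0) ⟩
  (1 + suc n C 1) * 1        ≡⟨ cong (λ z → (1 + z) * 1) (trans (sym (*-identityʳ (suc n C 1))) (C-absorption n 0)) ⟩
  (1 + 1 * suc n) * 1        ≡⟨ arith n ⟩
  1 * suc (suc n)            ∎
  where
  open ≡-Reasoning
  arith : ∀ n → (1 + 1 * suc n) * 1 ≡ 1 * suc (suc n)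
  arith = solve-∀
C-absorption (suc n) (suc k) = begin
  (suc (suc n) C suc (suc k)) * suc (suc k)      ≡⟨ cong (_* suc (suc k)) (pascal (suc n) (suc k)) ⟩
  (a + b) * suc (suc k)                          ≡⟨ expand a b k ⟩
  a * suc k + a + b * suc (suc k)                ≡⟨ cong₂ (λ x y → x + a + y) (C-absorption n k) (C-absorption n (suc k)) ⟩
  (n C k) * suc n + a + (n C suc k) * suc n      ≡⟨ collect (n C k) (n C suc k) a n ⟩
  ((n C k) + (n C suc k)) * suc n + a            ≡⟨ cong (λ z → z * suc n + a) (sym (pascal n k)) ⟩
  a * suc n + a                                  ≡⟨ *-suc′ a n ⟩
  a * suc (suc n)                                ∎
  where
  open ≡-Reasoning
  a = suc n C suc k
  b = suc n C suc (suc k)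
  expand : ∀ a b k → (a + b) * suc (suc k) ≡ a * suc k + a + b * suc (suc k)
  expand = solve-∀
  collect : ∀ x y a n → x * suc n + a + y * suc n ≡ (x + y) * suc n + a
  collect = solve-∀
  *-suc′ : ∀ a n → a * suc n + a ≡ a * suc (suc n)
  *-suc′ = solve-∀

countUnder≤-catalan : ∀ m L → L + 1 ≤ m → countUnder≤ L m (suc L) * suc L ≡ (L + L) C L
countUnder≤-catalan m zero     _   = refl
countUnder≤-catalan m (suc L′) L<m = +-cancelʳ-≡ (CL * L) (count * suc L) CL (trans (cong (count * suc L +_) (sym prev*L+1)) total)
  where
  L = suc L′
  n = L′ + suc L′
  CL = (L + L) C L
  count = countUnder≤ L m (suc L)
  prev = (L + L) C L′
  prev*L+1 : prev * suc L ≡ CL * L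
  prev*L+1 = begin
    prev * suc L                     ≡⟨ cong (_* suc L) (trans (nCk≡nC[n∸k] (≤-trans (m≤m+n L′ (suc L′)) (n≤1+n _)))
                                                               (cong (suc n C_) (trans (cong (_∸ L′) (sym (+-suc L′ (suc L′)))) (m+n∸m≡n L′ (suc (suc L′)))))) ⟩
    (suc n C suc (suc L′)) * suc (suc L′) ≡⟨ C-absorption n (suc L′) ⟩
    (n C suc L′) * suc n             ≡⟨ cong (_* suc n) (trans (nCk≡nC[n∸k] (m≤n+m (suc L′) L′)) (cong (n C_) (m+n∸n≡m L′ (suc L′)))) ⟩
    (n C L′) * suc n                 ≡⟨ sym (C-absorption n L′) ⟩
    CL * L                           ∎
    where open ≡-Reasoning
  total : count * suc L + prev * suc L ≡ CL + CL * L
  total = trans (sym (*-distribʳ-+ (suc L) count prev))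
                (trans (cong (_* suc L) (countUnder≤-ballot m L L L<m ≤-refl)) (*-suc CL L))

countUnder-catalan : ∀ L m → L + 1 ≤ m → countBounded suc 1 L m * suc L ≡ (L + L) C L
countUnder-catalan zero     m _   = refl
countUnder-catalan (suc L′) m L<m = trans (cong (_* suc (suc L′)) count≡) (countUnder≤-catalan m (suc L′) L<m)
  where
  open ≡-Reasoning
  count≡ : countBounded suc 1 (suc L′) m ≡ countUnder≤ (suc L′) m (suc (suc L′))
  count≡ = begin
    countBounded suc 1 (suc L′) m                        ≡⟨ sym (countBounded≤-full suc 1 (suc L′) m m ≤-refl) ⟩
    countUnder≤ (suc L′) m m                             ≡⟨ cong (countUnder≤ (suc L′) m) (sym (m+[n∸m]≡n (≤-trans (n≤1+n _) (≤-trans (≤-reflexive (+-comm 1 (suc L′))) L<m)))) ⟩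
    countUnder≤ (suc L′) m (suc L′ + (m ∸ suc L′))       ≡⟨ countUnder≤-saturated L′ m (m ∸ suc L′) ⟩
    countUnder≤ (suc L′) m (suc L′)                      ≡⟨ sym (countUnder≤-saturated L′ m 1) ⟩
    countUnder≤ (suc L′) m (suc L′ + 1)                  ≡⟨ cong (countUnder≤ (suc L′) m) (+-comm (suc L′) 1) ⟩
    countUnder≤ (suc L′) m (suc (suc L′))                ∎

countUnder₂≤-single : ∀ m w → 2 ≤ m → countUnder₂≤ 1 m (suc (suc w)) ≡ 1
countUnder₂≤-single m zero    2≤m =
  trans (countBounded≤-suc ceiling₂ 2 0 m 1)
        (cong₂ _+_ (trans (countBounded≤-suc ceiling₂ 2 0 m 0) (cong₂ _+_ (countUnder₂≤-zero 0 m) (when-∧-∧false (1 ≤ᵇ m) true 1)))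
                   (cong (λ b → when (b ∧ true) 1) (≤ᵇ-true 2≤m)))
countUnder₂≤-single m (suc w) 2≤m =
  trans (countBounded≤-suc ceiling₂ 2 0 m (suc (suc w))) (cong₂ _+_ (countUnder₂≤-single m w 2≤m) (when-∧-∧false (suc (suc (suc w)) ≤ᵇ m) false 1))

-- Removing 1 from every entry maps sequences with entries ≥ 2 under ceiling₂ onto those under the staircase.
countUnder₂≤-shift : ∀ m L w → L + 2 ≤ m → countUnder₂≤ (suc (suc L)) m (suc w) ≡ countUnder≤ (suc L) m w
countUnder₂≤-shift′ : ∀ m L w → L + 2 ≤ m → countUnder₂≤ (suc L) m (suc (suc w)) ≡ countUnder≤ L m (suc w)
countUnder₂≤-shift′ m zero     w L+2≤m = countUnder₂≤-single m w L+2≤m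
countUnder₂≤-shift′ m (suc L)  w L+2≤m = countUnder₂≤-shift m L (suc w) (≤-trans (n≤1+n _) L+2≤m)
countUnder₂≤-shift m L zero     L+2≤m =
  trans (countBounded≤-suc ceiling₂ 2 (suc L) m 0)
        (trans (cong₂ _+_ (countUnder₂≤-zero (suc L) m) (when-∧-∧false (1 ≤ᵇ m) true _)) (sym (countUnder≤-zero L m)))
countUnder₂≤-shift m L (suc w) L+2≤m = begin
  countUnder₂≤ (suc (suc L)) m (suc (suc w))
    ≡⟨ countBounded≤-suc ceiling₂ 2 (suc L) m (suc w) ⟩
  countUnder₂≤ (suc (suc L)) m (suc w) + when ((suc (suc w) ≤ᵇ m) ∧ ((w <ᵇ suc L) ∧ true)) (countUnder₂≤ (suc L) m (suc (suc w)))
    ≡⟨ cong₂ _+_ (countUnder₂≤-shift m L w L+2≤m) newHead ⟩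
  countUnder≤ (suc L) m w + when ((suc w ≤ᵇ m) ∧ ((w <ᵇ suc L) ∧ true)) (countUnder≤ L m (suc w))
    ≡⟨ sym (countBounded≤-suc suc 1 L m w) ⟩
  countUnder≤ (suc L) m (suc w) ∎
  where
  open ≡-Reasoning
  newHead : when ((suc (suc w) ≤ᵇ m) ∧ ((w <ᵇ suc L) ∧ true)) (countUnder₂≤ (suc L) m (suc (suc w)))
            ≡ when ((suc w ≤ᵇ m) ∧ ((w <ᵇ suc L) ∧ true)) (countUnder≤ L m (suc w))
  newHead with w <? suc L
  ... | yes w<1+L rewrite <ᵇ-true w<1+L
                        | ≤ᵇ-true {suc (suc w)} {m} (≤-trans (s≤s w<1+L) (≤-trans (≤-reflexive (+-comm 2 L)) L+2≤m))
                        | ≤ᵇ-true {suc w} {m} (≤-trans (n≤1+n _) (≤-trans (s≤s w<1+L) (≤-trans (≤-reflexive (+-comm 2 L)) L+2≤m))) =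
                          countUnder₂≤-shift′ m L w L+2≤m
  ... | no w≮1+L rewrite <ᵇ-false {w} {suc L} (≮⇒≥ w≮1+L) =
                          trans (when-∧-∧false (suc (suc w) ≤ᵇ m) false _) (sym (when-∧-∧false (suc w ≤ᵇ m) false _))

countUnder₂-shift : ∀ L m → L + 2 ≤ m → countBounded ceiling₂ 2 (suc (suc L)) m ≡ countBounded suc 1 (suc L) m
countUnder₂-shift L m L+2≤m = begin
  countBounded ceiling₂ 2 (suc (suc L)) m     ≡⟨ sym (countBounded≤-full ceiling₂ 2 (suc (suc L)) m (suc m) (n≤1+n m)) ⟩
  countUnder₂≤ (suc (suc L)) m (suc m)        ≡⟨ countUnder₂≤-shift m L m L+2≤m ⟩
  countUnder≤ (suc L) m m                     ≡⟨ countBounded≤-full suc 1 (suc L) m m ≤-refl ⟩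
  countBounded suc 1 (suc L) m                ∎
  where open ≡-Reasoning

+-≡ᵇ0 : ∀ a b → (a + b ≡ᵇ 0) ≡ (a ≡ᵇ 0) ∧ (b ≡ᵇ 0)
+-≡ᵇ0 zero    b = refl
+-≡ᵇ0 (suc a) b = refl

∸-≡ᵇ0 : ∀ k n → (k ∸ n ≡ᵇ 0) ≡ (k ≤ᵇ n)
∸-≡ᵇ0 zero    zero    = refl
∸-≡ᵇ0 zero    (suc n) = refl
∸-≡ᵇ0 (suc k) zero    = refl
∸-≡ᵇ0 (suc k) (suc n) = trans (∸-≡ᵇ0 k n) (sym (<ᵇ-suc k n))

boundedBy-staircase : ∀ {n} (ks : Vec ℕ n) → boundedBy suc 1 ks ≡ (belowDiagonal ks ≡ᵇ 0) ∧ allPositive ks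
boundedBy-staircase []               = refl
boundedBy-staircase {suc n} (k ∷ ks)
  rewrite +-≡ᵇ0 (k ∸ suc n) (belowDiagonal ks) | ∸-≡ᵇ0 k (suc n) | boundedBy-staircase ks =
  ∧-interchange′ (k ≤ᵇ suc n) (1 ≤ᵇ k) (belowDiagonal ks ≡ᵇ 0) (allPositive ks)
  where
  ∧-interchange′ : ∀ a b c d → a ∧ (b ∧ (c ∧ d)) ≡ (a ∧ c) ∧ (b ∧ d)
  ∧-interchange′ a b c d = trans (cong (a ∧_) (trans (sym (∧-assoc b c d)) (trans (cong (_∧ d) (∧-comm b c)) (∧-assoc c b d))))
                                 (sym (∧-assoc a c (b ∧ d)))

allAtLeast₂⇒allPositive : ∀ {n} (ks : Vec ℕ n) → allAtLeast₂ ks ≡ true → allPositive ks ≡ true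
allAtLeast₂⇒allPositive []                 _ = refl
allAtLeast₂⇒allPositive (suc (suc k) ∷ ks) e = allAtLeast₂⇒allPositive ks e

allAtLeast₂⇒belowDiagonal : ∀ {n} (ks : Vec ℕ (suc n)) → allAtLeast₂ ks ≡ true → 1 ≤ belowDiagonal ks
allAtLeast₂⇒belowDiagonal {zero}  (suc (suc k) ∷ []) _ = s≤s z≤n
allAtLeast₂⇒belowDiagonal {suc n} (suc (suc k) ∷ ks) e =
  ≤-trans (allAtLeast₂⇒belowDiagonal ks e) (m≤n+m _ (suc (suc k) ∸ suc (suc n)))

boundedBy-ceiling₂ : ∀ {n} (ks : Vec ℕ (suc n)) → boundedBy ceiling₂ 2 ks ≡ (belowDiagonal ks ≡ᵇ 1) ∧ allAtLeast₂ ks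
boundedBy-ceiling₂ {zero}  (zero ∷ [])                = refl
boundedBy-ceiling₂ {zero}  (suc zero ∷ [])            = refl
boundedBy-ceiling₂ {zero}  (suc (suc zero) ∷ [])      = refl
boundedBy-ceiling₂ {zero}  (suc (suc (suc k)) ∷ [])   = refl
boundedBy-ceiling₂ {suc n} (k ∷ ks) rewrite boundedBy-ceiling₂ ks with allAtLeast₂ ks in ks≥2
... | false rewrite ∧-zeroʳ (belowDiagonal ks ≡ᵇ 1) | ∧-zeroʳ (2 ≤ᵇ k) | ∧-zeroʳ (k ≤ᵇ suc (suc n)) =
  sym (∧-zeroʳ (k ∸ suc (suc n) + belowDiagonal ks ≡ᵇ 1))
... | true  = headCase (belowDiagonal ks) (allAtLeast₂⇒belowDiagonal ks ks≥2)
  where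
  sum≢1 : ∀ d B → 1 ≤ d → d + suc B ≢ 1
  sum≢1 (suc d) B _ e = 0≢1+n (sym (trans (sym (+-suc d B)) (suc-injective e)))
  headCase : ∀ B → 1 ≤ B → (k ≤ᵇ suc (suc n)) ∧ ((2 ≤ᵇ k) ∧ ((B ≡ᵇ 1) ∧ true)) ≡ ((k ∸ suc (suc n) + B ≡ᵇ 1) ∧ ((2 ≤ᵇ k) ∧ true))
  headCase (suc B) _ with k ≤? suc (suc n)
  ... | yes k≤ rewrite ≤ᵇ-true k≤ | m≤n⇒m∸n≡0 k≤ | ∧-identityʳ (2 ≤ᵇ k) | ∧-identityʳ (B ≡ᵇ 0) = ∧-comm (2 ≤ᵇ k) (B ≡ᵇ 0)
  ... | no k≰  rewrite ≤ᵇ-false (≰⇒> k≰) | ≡ᵇ-false (sum≢1 (k ∸ suc (suc n)) B (m<n⇒0<n∸m (≰⇒> k≰))) = refl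

staircase-split : ∀ {n} (ks : Vec ℕ (suc n)) →
                  𝟙 (allPositive ks ∧ (belowDiagonal ks ≡ᵇ 𝟙 (allAtLeast₂ ks))) ≡ 𝟙 (boundedBy suc 1 ks) + 𝟙 (boundedBy ceiling₂ 2 ks)
staircase-split ks rewrite boundedBy-staircase ks | boundedBy-ceiling₂ ks with allAtLeast₂ ks in ks≥2
... | false rewrite ∧-zeroʳ (belowDiagonal ks ≡ᵇ 1) | ∧-comm (allPositive ks) (belowDiagonal ks ≡ᵇ 0) = sym (+-identityʳ _)
... | true  rewrite allAtLeast₂⇒allPositive ks ks≥2 | ≡ᵇ-false (≢-sym (<⇒≢ (allAtLeast₂⇒belowDiagonal ks ks≥2)))
                  | ∧-identityʳ (belowDiagonal ks ≡ᵇ 1) = refl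

-- row lengths of the Ferrers diagrams F with (F , 3) MDS-constructible
mdsRows : ∀ {N′} → Vec ℕ (suc (suc N′)) → Bool
mdsRows {N′} (k₁ ∷ k₂ ∷ ks) =
  (suc (suc N′) ≤ᵇ k₁) ∧ (allPositive (k₁ ∷ k₂ ∷ ks) ∧ (belowDiagonal (k₁ ∷ k₂ ∷ ks) ≡ᵇ 𝟙 (allAtLeast₂ (k₂ ∷ ks) ∨ (k₂ ≡ᵇ suc (suc N′)))))

allPositive⇒1≤head₀ : ∀ {n} (ks : Vec ℕ (suc n)) → allPositive ks ≡ true → 1 ≤ head₀ ks
allPositive⇒1≤head₀ (suc k ∷ ks) _ = s≤s z≤n

1≤ᵇlast≡allPositive : ∀ {n m} (ks : Vec ℕ (suc n)) → IsPartition m ks → (1 ≤ᵇ entry ks (suc n)) ≡ allPositive ks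
1≤ᵇlast≡allPositive {zero}  (k ∷ []) _ = sym (∧-identityʳ (1 ≤ᵇ k))
1≤ᵇlast≡allPositive {suc n} (k ∷ ks) (_ , h≤k , valid) with allPositive ks in pos
... | true  rewrite 1≤ᵇlast≡allPositive ks valid | pos | ≤ᵇ-true {1} {k} (≤-trans (allPositive⇒1≤head₀ ks pos) h≤k) = refl
... | false rewrite 1≤ᵇlast≡allPositive ks valid | pos = sym (∧-zeroʳ (1 ≤ᵇ k))

mem-ferrers-corner : ∀ N′ (ks : Vec ℕ (suc (suc N′))) → mem (ferrers {m = suc (suc N′)} ks) (suc (suc N′)) (suc (suc N′)) ≡ (1 ≤ᵇ entry ks (suc (suc N′)))
mem-ferrers-corner N′ ks = trans (mem-ferrers ks (suc N′) (suc (suc N′)) ≤-refl) (trans (vget-suffix (suc (suc N′)) _ (suc N′) ≤-refl) (<ᵇ-+ (suc (suc N′)) _))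
  where
  <ᵇ-+ : ∀ n k → (n <ᵇ n + k) ≡ (1 ≤ᵇ k)
  <ᵇ-+ zero    k = refl
  <ᵇ-+ (suc n) k = <ᵇ-+ n k

corners∧MDS≡mdsRows : ∀ N′ (ks : Vec ℕ (suc (suc N′))) → IsPartition (suc (suc N′)) ks →
  let F = ferrers {m = suc (suc N′)} ks in
  mem F 1 1 ∧ (mem F (suc (suc N′)) (suc (suc N′)) ∧ isMDSConstructible F 3) ≡ mdsRows ks
corners∧MDS≡mdsRows N′ (k₁ ∷ k₂ ∷ ks) valid with suc (suc N′) ≤? k₁
... | no k₁<N  rewrite ≤ᵇ-false (≰⇒> k₁<N) = refl
... | yes N≤k₁ with ≤-antisym (proj₁ valid) N≤k₁
...   | refl rewrite mem-ferrers-corner N′ (k₁ ∷ k₂ ∷ ks) | 1≤ᵇlast≡allPositive (k₁ ∷ k₂ ∷ ks) valid with allPositive (k₁ ∷ k₂ ∷ ks) in pos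
...     | true  = cong ((N′ <ᵇ suc N′) ∧_) (MDSCharacterisation.isMDSConstructible-ferrers N′ k₂ ks valid (subst T (sym pos) tt))
...     | false = refl

module _ (N″ : ℕ) where
  private
    N′ = suc N″
    N  = suc (suc N′)

  countMDSFerrers≡∑-mdsRows : countMDSFerrers N 3 ≡ ∑ (partitions N N) (𝟙 ∘ mdsRows)
  countMDSFerrers≡∑-mdsRows = begin
    countMDSFerrers N 3                                                       ≡⟨ length-filterᵇ≡∑ _ (allSubsets N N) ⟩
    ∑ (allSubsets N N) (λ F → 𝟙 (isFerrers F ∧ isMDSConstructible F 3))
      ≡⟨ ∑-cong (allSubsets N N) (λ F → corners-first (mem F 1 1) (mem F N N) (isClosed F) (isMDSConstructible F 3)) ⟩
    ∑ (allSubsets N N) (λ F → when (isClosed F) (𝟙 (cornersMDS F)))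
      ≡⟨ ∑-closed≡∑-partitions N N (𝟙 ∘ cornersMDS) ⟩
    ∑ (partitions N N) (λ ks → 𝟙 (cornersMDS (ferrers ks)))
      ≡⟨ ∑-cong-All (partitions N N) (partitions-valid N N) (λ ks valid → cong 𝟙 (corners∧MDS≡mdsRows N′ ks valid)) ⟩
    ∑ (partitions N N) (𝟙 ∘ mdsRows)                                          ∎
    where
    open ≡-Reasoning
    cornersMDS : Subset N N → Bool
    cornersMDS F = mem F 1 1 ∧ (mem F N N ∧ isMDSConstructible F 3)
    corners-first : ∀ a b c d → 𝟙 ((a ∧ (b ∧ c)) ∧ d) ≡ when c (𝟙 (a ∧ (b ∧ d)))
    corners-first true  true  true  d = refl
    corners-first true  true  false d = refl
    corners-first true  false true  d = refl
    corners-first true  false false d = refl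
    corners-first false b     true  d = refl
    corners-first false b     false d = refl

  private
    under over : ∀ {n} → Vec ℕ n → ℕ
    under = 𝟙 ∘ boundedBy suc 1
    over  = 𝟙 ∘ boundedBy ceiling₂ 2

    mdsRowsBelow : Vec ℕ (suc N′) → ℕ
    mdsRowsBelow v = 𝟙 (allPositive (N ∷ v) ∧ (belowDiagonal (N ∷ v) ≡ᵇ 𝟙 (allAtLeast₂ v ∨ (head₀ v ≡ᵇ N))))

  -- k₂ = N puts one cell of row 2 below the diagonal; otherwise split as in staircase-split.
  mdsRowsBelow-cases : ∀ v → IsPartition N v → mdsRowsBelow v ≡ when (head₀ v <ᵇ N) (under v + over v) + when (head₀ v ≡ᵇ N) (under (Vec.tail v))
  mdsRowsBelow-cases (k₂ ∷ ks) (k₂≤N , _) rewrite n∸n≡0 N with k₂ ≟ N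
  ... | yes refl rewrite ≡ᵇ-true {N} refl | ∨-zeroʳ (allAtLeast₂ ks) | <ᵇ-false {N} {N} ≤-refl
                       | m+n∸n≡m 1 N″ | boundedBy-staircase ks | ∧-comm (belowDiagonal ks ≡ᵇ 0) (allPositive ks) = refl
  ... | no k₂≢N  rewrite ≡ᵇ-false k₂≢N | ∨-identityʳ (allAtLeast₂ (k₂ ∷ ks)) | <ᵇ-true (≤∧≢⇒< k₂≤N k₂≢N) =
                         trans (staircase-split (k₂ ∷ ks)) (sym (+-identityʳ _))

  ∑-mdsRows : ∑ (partitions N N) (𝟙 ∘ mdsRows) ≡ countBounded suc 1 (suc N′) N + countBounded ceiling₂ 2 (suc N′) N + countBounded suc 1 N′ N
  ∑-mdsRows = begin
    ∑ (partitions N N) (𝟙 ∘ mdsRows)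
      ≡⟨ ∑-partitions-∷ (suc N′) N (𝟙 ∘ mdsRows) ⟩
    ∑ (partitions (suc N′) N) (λ v → ∑ (fromTo (head₀ v) N) (λ k₁ → 𝟙 (mdsRows (k₁ ∷ v))))
      ≡⟨ ∑-cong-All (partitions (suc N′) N) (partitions-valid (suc N′) N) (λ v valid →
           trans (firstRowFull v valid) (mdsRowsBelow-cases v valid)) ⟩
    ∑ (partitions (suc N′) N) (λ v → when (head₀ v <ᵇ N) (under v + over v) + when (head₀ v ≡ᵇ N) (under (Vec.tail v)))
      ≡⟨ ∑-+ (partitions (suc N′) N) _ _ ⟩
    ∑ (partitions (suc N′) N) (λ v → when (head₀ v <ᵇ N) (under v + over v)) + ∑ (partitions (suc N′) N) (λ v → when (head₀ v ≡ᵇ N) (under (Vec.tail v)))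
      ≡⟨ cong₂ _+_ (trans (∑-cong (partitions (suc N′) N) dropGuard) (∑-+ (partitions (suc N′) N) under over)) secondRowFull ⟩
    countBounded suc 1 (suc N′) N + countBounded ceiling₂ 2 (suc N′) N + countBounded suc 1 N′ N ∎
    where
    open ≡-Reasoning
    firstRowFull : ∀ v → IsPartition N v → ∑ (fromTo (head₀ v) N) (λ k₁ → 𝟙 (mdsRows (k₁ ∷ v))) ≡ mdsRowsBelow v
    firstRowFull (k₂ ∷ ks) valid =
      trans (∑-cong (fromTo k₂ N) (λ k₁ → when-∧ (N ≤ᵇ k₁) _ 1)) (∑-fromTo-last k₂ N _ (head₀≤bound (k₂ ∷ ks) valid))
    -- an entry k₂ ≥ N exceeds both ceilings
    dropGuard : ∀ v → when (head₀ v <ᵇ N) (under v + over v) ≡ under v + over v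
    dropGuard (k₂ ∷ ks) with k₂ <? N
    ... | yes k₂<N rewrite <ᵇ-true k₂<N = refl
    ... | no k₂≮N  rewrite <ᵇ-false {k₂} {N} (≮⇒≥ k₂≮N) | ≤ᵇ-false {k₂} {suc N′} (≮⇒≥ k₂≮N) = refl
    secondRowFull : ∑ (partitions (suc N′) N) (λ v → when (head₀ v ≡ᵇ N) (under (Vec.tail v))) ≡ countBounded suc 1 N′ N
    secondRowFull = trans (∑-partitions-∷ N′ N _) (∑-cong-All (partitions N′ N) (partitions-valid N′ N) (λ ks valid →
      trans (∑-fromTo-single (head₀ ks) N N (λ _ → under ks))
            (cong₂ (λ a b → when (a ∧ b) (under ks)) (≤ᵇ-true (head₀≤bound ks valid)) (≤ᵇ-true {N} ≤-refl))))

central-binomial÷ : ∀ L c → c * suc L ≡ (L + L) C L → ((2 * L) C L) / suc L ≡ c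
central-binomial÷ L c c*[L+1] =
  trans (cong (λ z → (z C L) / suc L) (cong (L +_) (+-identityʳ L))) (trans (cong (_/ suc L) (sym c*[L+1])) (m*n/n≡m c (suc L)))

2*central-binomial÷ : ∀ L c → c * suc L ≡ (L + L) C L → (2 * ((2 * L) C L)) / suc L ≡ c + c
2*central-binomial÷ L c c*[L+1] = begin
  (2 * ((2 * L) C L)) / suc L     ≡⟨ cong (λ z → (2 * (z C L)) / suc L) (cong (L +_) (+-identityʳ L)) ⟩
  (2 * ((L + L) C L)) / suc L     ≡⟨ cong (λ z → (2 * z) / suc L) (sym c*[L+1]) ⟩
  (2 * (c * suc L)) / suc L       ≡⟨ cong (_/ suc L) (sym (*-assoc 2 c (suc L))) ⟩
  (2 * c * suc L) / suc L         ≡⟨ m*n/n≡m (2 * c) (suc L) ⟩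
  2 * c                           ≡⟨ cong (c +_) (+-identityʳ c) ⟩
  c + c                           ∎
  where open ≡-Reasoning

corollary5p10 : (n : ℕ) → 3 ≤ n → countMDSFerrers n 3 ≡ formula n
corollary5p10 (suc (suc (suc N″))) (s≤s (s≤s (s≤s z≤n))) = begin
  countMDSFerrers N 3                          ≡⟨ countMDSFerrers≡∑-mdsRows N″ ⟩
  ∑ (partitions N N) (𝟙 ∘ mdsRows)             ≡⟨ ∑-mdsRows N″ ⟩
  a + countBounded ceiling₂ 2 N′ N + b         ≡⟨ cong (λ z → a + z + b) (countUnder₂-shift N″ N N″+2≤N) ⟩
  a + b + b                                    ≡⟨ +-assoc a b b ⟩
  a + (b + b)                                  ≡⟨ sym (cong₂ _+_ (central-binomial÷ N′ a (countUnder-catalan N′ N (≤-reflexive (+-comm N′ 1))))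
                                                                 (2*central-binomial÷ (suc N″) b (countUnder-catalan (suc N″) N (≤-trans (≤-reflexive (+-comm (suc N″) 1)) (n≤1+n _))))) ⟩
  formula N                                    ∎
  where
  open ≡-Reasoning
  N′ = suc (suc N″)
  N  = suc N′
  a = countBounded suc 1 N′ N
  b = countBounded suc 1 (suc N″) N
  N″+2≤N : N″ + 2 ≤ N
  N″+2≤N = ≤-trans (≤-reflexive (+-comm N″ 2)) (n≤1+n _)
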